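{- For every integer $t\ge 1$ and all $k$, \[ P(GS_{5t+3,t,2t},k)=P(GS_{5t+1,t+1,2t+1},k). \]
   Context: Forest building process: given a finite graph $G$ and a linear ordering of its edges, go through the edges in order and keep an edge if and only if at least one of its endpoints is not an endpoint of any earlier edge in the ordering (earlier edges count whether or not they were kept). The kept edges form a forest. $P(G,k)$ denotes the probability that, for a uniformly random ordering of the edges of $G$, the resulting forest has exactly $k$ trees. The glued-star graph $GS_{a,b,c}$ has two center vertices $u,w$, $a$ vertices adjacent only to $u$, $b$ vertices adjacent to both $u$ and $w$, and $c$ vertices adjacent only to $w$ (i.e., the stars $K_{1,a+b}$ and $K_{1,b+c}$ with $b$ of their leaves identified). -}

module Defs where

open import Data.Nat using (ℕ; zero; suc; _+_; _≡ᵇ_; _<ᵇ_; _!)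
open import Data.Nat.Properties using (_!≢0)
open import Data.Bool using (Bool; true; false; _∨_; _∧_; not; if_then_else_)
open import Data.List using (List; []; _∷_; _++_; map; concatMap; length; filter; upTo)
open import Data.Bool.ListAction using (any)
open import Data.Product using (_×_; _,_; proj₁; proj₂)
open import Data.Integer using () renaming (+_ to ℤ+)
open import Data.Rational using (ℚ; _/_)
open import Relation.Nullary.Decidable using (⌊_⌋)
open import Relation.Unary using (Decidable)
import Data.Nat as ℕ

-- A finite graph: an explicit list of vertices (natural-number labels)
-- and a list of edges (unordered pairs, stored as ordered pairs).
Edge : Set
Edge = ℕ × ℕ

record Graph : Set where
  constructor mkGraph
  field
    vertices : List ℕ
    edges    : List Edge
open Graph public

count : {A : Set} → (A → Bool) → List A → ℕ
count p []       = 0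
count p (x ∷ xs) = if p x then suc (count p xs) else count p xs

elem : ℕ → List ℕ → Bool
elem x []       = false
elem x (y ∷ ys) = (x ≡ᵇ y) ∨ elem x ys

insertions : {A : Set} → A → List A → List (List A)
insertions x []       = (x ∷ []) ∷ []
insertions x (y ∷ ys) = (x ∷ y ∷ ys) ∷ map (y ∷_) (insertions x ys)

orderings : {A : Set} → List A → List (List A)
orderings []       = [] ∷ []
orderings (x ∷ xs) = concatMap (insertions x) (orderings xs)

-- Forest building process: scan the edges in order; keep an edge iff at
-- least one endpoint is not an endpoint of any EARLIER edge (kept or not).
-- 'seen' = endpoints of all earlier edges.
forestFrom : List ℕ → List Edge → List Edge
forestFrom seen []            = []
forestFrom seen ((x , y) ∷ es) with not (elem x seen) ∨ not (elem y seen)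
... | true  = (x , y) ∷ forestFrom (x ∷ y ∷ seen) es
... | false = forestFrom (x ∷ y ∷ seen) es

forest : List Edge → List Edge
forest = forestFrom []

adjacent : List Edge → ℕ → ℕ → Bool
adjacent F a b = any (λ e → ((proj₁ e ≡ᵇ a) ∧ (proj₂ e ≡ᵇ b)) ∨ ((proj₁ e ≡ᵇ b) ∧ (proj₂ e ≡ᵇ a))) F

reachW : List ℕ → List Edge → ℕ → ℕ → ℕ → Bool
reachW V F zero    v w = v ≡ᵇ w
reachW V F (suc n) v w = reachW V F n v w ∨ any (λ u → reachW V F n v u ∧ adjacent F u w) V

-- v and w lie in the same connected component of (V, F)
-- (walks of length ≤ |V| suffice in a graph on |V| vertices).
connected : List ℕ → List Edge → ℕ → ℕ → Bool
connected V F v w = reachW V F (length V) v w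

-- Number of connected components of (V, F): count vertices that are the
-- least label in their component.
numComponents : List ℕ → List Edge → ℕ
numComponents V F =
  count (λ v → not (any (λ w → (w <ᵇ v) ∧ connected V F v w) V)) V

-- number of trees of the forest produced from the ordering 'ord' of the
-- edges of G (the forest is the spanning subgraph (V(G), kept edges))
numTrees : Graph → List Edge → ℕ
numTrees G ord = numComponents (vertices G) (forest ord)

-- P(G,k): probability over a uniformly random ordering of E(G) that the
-- forest has exactly k trees = #(orderings giving k trees) / |E(G)|!
P : Graph → ℕ → ℚ
P G k = (ℤ+ (count (λ ord → numTrees G ord ≡ᵇ k) (orderings (edges G))))
        / (length (edges G) !) where instance _ = length (edges G) !≢0

-- Glued star GS_{a,b,c}: centres u = 0, w = 1;
-- vertices 2 .. a+1 adjacent only to u,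
-- vertices a+2 .. a+b+1 adjacent to both u and w,
-- vertices a+b+2 .. a+b+c+1 adjacent only to w.
range : ℕ → ℕ → List ℕ
range s n = map (λ i → s ℕ.+ i) (upTo n)

GS : ℕ → ℕ → ℕ → Graph
GS a b c = mkGraph
  (0 ∷ 1 ∷ range 2 (a + b + c))
  (map (λ x → (0 , x)) (range 2 a)
   ++ concatMap (λ x → (0 , x) ∷ (1 , x) ∷ []) (range (2 + a) b)
   ++ map (λ x → (1 , x)) (range (2 + a + b) c))

module Submission where

-- Every leaf of a glued star keeps its first edge, so the forest spans all
-- leaves and has one tree (the two stars meet) or two.  The stars meet iff
-- the first edge (c' , z) at the centre c' used second has a leaf z already
-- joined to the centre c used first.  Splitting by c and by the shared leaf
-- x, the event "(c , x) precedes every edge at c', and (c' , x) is the first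
-- of them" has probability 1 / ((d + 1) d), d = deg c': only the relative
-- order of d + 1 edges matters.  Hence GS_{a,b,c} is a tree with
-- probability b (1/((b+c+1)(b+c)) + 1/((a+b+1)(a+b))), which agrees for
-- the two parameter triples; P(·,2) = 1 - P(·,1) and all other P vanish.

open import Data.Nat using (ℕ; zero; suc; _+_; _*_; _∸_; _≤_; _<_; _!; NonZero; z≤n; s≤s; _≡ᵇ_; _<ᵇ_)
open import Data.Nat.Properties
open import Data.Nat.Tactic.RingSolver using (solve-∀)
open import Data.Bool using (Bool; true; false; _∨_; _∧_; not; if_then_else_)
open import Data.Bool.Properties using (not-injective; ∨-identityʳ; ∨-zeroʳ; ∧-identityʳ; ∧-zeroʳ; ∧-conicalˡ; ∧-conicalʳ; T-≡)
open import Data.Bool.ListAction using (any)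
open import Data.List using (List; []; _∷_; _++_; map; concatMap; length; applyUpTo)
open import Data.List.Properties using (length-map; length-++; map-applyUpTo; ++-assoc)
open import Data.List.Relation.Unary.All as All using (All; []; _∷_)
open import Data.List.Relation.Unary.All.Properties using (++⁺; map⁺; concat⁺)
open import Data.List.Relation.Unary.Any using (Any; here; there)
open import Data.List.Relation.Unary.Any.Properties using (++⁺ˡ; ++⁺ʳ)
open import Data.List.Membership.Propositional using (_∈_; _∉_; find; lose)
open import Data.List.Membership.Propositional.Properties using (∈-map⁺)
open import Data.List.Relation.Binary.Permutation.Propositional as Perm using (_↭_; ↭-refl; ↭-sym; ↭-trans; ↭-prep; ↭-swap; ↭-reflexive; module PermutationReasoning)
open import Data.List.Relation.Binary.Permutation.Propositional.Properties using (shift; shifts; ++-comm; ↭-length) renaming (++⁺ˡ to ↭-++⁺ˡ; ++⁺ʳ to ↭-++⁺ʳ; ++⁺ to ↭-++⁺)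
open import Data.Product using (_×_; _,_; proj₁; proj₂; ∃-syntax)
open import Data.Sum using (_⊎_; inj₁; inj₂)
open import Data.Empty using (⊥-elim)
open import Data.Integer using () renaming (+_ to ℤ+)
open import Data.Integer.Properties using (pos-*)
open import Data.Rational using (_/_)
open import Data.Rational.Properties using (fromℚᵘ-cong)
open import Data.Rational.Unnormalised.Base using (*≡*; mkℚᵘ)
open import Function using (Equivalence)
open import Relation.Nullary using (yes; no)
open import Relation.Binary.PropositionalEquality
open import Defs

∑ : {A : Set} → (A → ℕ) → List A → ℕ
∑ f []       = 0
∑ f (x ∷ xs) = f x + ∑ f xs

χ : Bool → ℕ
χ true  = 1
χ false = 0

count≡∑ : {A : Set} (p : A → Bool) (xs : List A) → count p xs ≡ ∑ (λ x → χ (p x)) xs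
count≡∑ p []       = refl
count≡∑ p (x ∷ xs) with p x
... | true  = cong suc (count≡∑ p xs)
... | false = count≡∑ p xs

count-none : {A : Set} (p : A → Bool) (xs : List A) → All (λ x → p x ≡ false) xs → count p xs ≡ 0
count-none p []       []       = refl
count-none p (x ∷ xs) (q ∷ qs) rewrite q = count-none p xs qs

length≡∑ : {A : Set} (xs : List A) → length xs ≡ ∑ (λ _ → 1) xs
length≡∑ []       = refl
length≡∑ (x ∷ xs) = cong suc (length≡∑ xs)

∑-++ : {A : Set} (f : A → ℕ) (xs ys : List A) → ∑ f (xs ++ ys) ≡ ∑ f xs + ∑ f ys
∑-++ f []       ys = refl
∑-++ f (x ∷ xs) ys = trans (cong (f x +_) (∑-++ f xs ys)) (sym (+-assoc (f x) _ _))

∑-map : {A B : Set} (f : B → ℕ) (g : A → B) (xs : List A) → ∑ f (map g xs) ≡ ∑ (λ x → f (g x)) xs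
∑-map f g []       = refl
∑-map f g (x ∷ xs) = cong (f (g x) +_) (∑-map f g xs)

∑-concatMap : {A B : Set} (f : B → ℕ) (g : A → List B) (xs : List A) →
  ∑ f (concatMap g xs) ≡ ∑ (λ x → ∑ f (g x)) xs
∑-concatMap f g []       = refl
∑-concatMap f g (x ∷ xs) = trans (∑-++ f (g x) (concatMap g xs)) (cong (∑ f (g x) +_) (∑-concatMap f g xs))

∑-cong : {A : Set} {f g : A → ℕ} {xs : List A} → All (λ x → f x ≡ g x) xs → ∑ f xs ≡ ∑ g xs
∑-cong []       = refl
∑-cong (p ∷ ps) = cong₂ _+_ p (∑-cong ps)

∑-ext : {A : Set} {f g : A → ℕ} → (∀ x → f x ≡ g x) → (xs : List A) → ∑ f xs ≡ ∑ g xs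
∑-ext e xs = ∑-cong {xs = xs} (All.tabulate (λ {x} _ → e x))

∑-zero : {A : Set} (f : A → ℕ) (xs : List A) → (∀ x → f x ≡ 0) → ∑ f xs ≡ 0
∑-zero f []       h = refl
∑-zero f (x ∷ xs) h rewrite h x = ∑-zero f xs h

∑-const : {A : Set} (k : ℕ) (xs : List A) → ∑ (λ _ → k) xs ≡ k * length xs
∑-const k []       = sym (*-zeroʳ k)
∑-const k (x ∷ xs) = trans (cong (k +_) (∑-const k xs)) (sym (*-suc k (length xs)))

∑-+ : {A : Set} (f g : A → ℕ) (xs : List A) → ∑ (λ x → f x + g x) xs ≡ ∑ f xs + ∑ g xs
∑-+ f g []       = refl
∑-+ f g (x ∷ xs) rewrite ∑-+ f g xs = interchange (f x) (g x) (∑ f xs) (∑ g xs)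
  where
  interchange : ∀ a b c d → a + b + (c + d) ≡ a + c + (b + d)
  interchange = solve-∀

∑-*ˡ : {A : Set} (k : ℕ) (f : A → ℕ) (xs : List A) → ∑ (λ x → k * f x) xs ≡ k * ∑ f xs
∑-*ˡ k f []       = sym (*-zeroʳ k)
∑-*ˡ k f (x ∷ xs) = trans (cong (k * f x +_) (∑-*ˡ k f xs)) (sym (*-distribˡ-+ k (f x) (∑ f xs)))

∑-*ʳ : {A : Set} (f : A → ℕ) (k : ℕ) (xs : List A) → ∑ f xs * k ≡ ∑ (λ x → f x * k) xs
∑-*ʳ f k xs = trans (*-comm (∑ f xs) k) (trans (sym (∑-*ˡ k f xs)) (∑-ext (λ x → *-comm k (f x)) xs))

∑-swap : {A B : Set} (f : A → B → ℕ) (xs : List A) (ys : List B) →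
  ∑ (λ x → ∑ (f x) ys) xs ≡ ∑ (λ y → ∑ (λ x → f x y) xs) ys
∑-swap f []       ys = sym (∑-zero _ ys (λ _ → refl))
∑-swap f (x ∷ xs) ys = trans (cong (∑ (f x) ys +_) (∑-swap f xs ys)) (sym (∑-+ (f x) _ ys))

insertions-All : {A : Set} {P : A → Set} (x : A) {xs : List A} →
  P x → All P xs → All (All P) (insertions x xs)
insertions-All x px []        = (px ∷ []) ∷ []
insertions-All x px (py ∷ ps) = (px ∷ py ∷ ps) ∷ map⁺ (All.map (py ∷_) (insertions-All x px ps))

orderings-All : {A : Set} {P : A → Set} {xs : List A} → All P xs → All (All P) (orderings xs)
orderings-All []                  = [] ∷ []
orderings-All {xs = x ∷ _} (p ∷ ps) = concat⁺ (map⁺ (All.map (insertions-All x p) (orderings-All ps)))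

insertions-Any-old : {A : Set} {P : A → Set} (x : A) {xs : List A} → Any P xs → All (Any P) (insertions x xs)
insertions-Any-old x {y ∷ ys} (here p)  = there (here p) ∷ map⁺ (All.tabulate (λ _ → here p))
insertions-Any-old x {y ∷ ys} (there q) = there (there q) ∷ map⁺ (All.map there (insertions-Any-old x q))

insertions-Any-new : {A : Set} {P : A → Set} (x : A) (xs : List A) → P x → All (Any P) (insertions x xs)
insertions-Any-new x []       px = here px ∷ []
insertions-Any-new x (y ∷ ys) px = here px ∷ map⁺ (All.map there (insertions-Any-new x ys px))

orderings-Any : {A : Set} {P : A → Set} {xs : List A} → Any P xs → All (Any P) (orderings xs)
orderings-Any {xs = x ∷ xs} (here p)  =
  concat⁺ (map⁺ (All.tabulate {xs = orderings xs} (λ {τ} _ → insertions-Any-new x τ p)))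
orderings-Any {xs = x ∷ xs} (there q) = concat⁺ (map⁺ (All.map (insertions-Any-old x) (orderings-Any q)))

insertions-length : {A : Set} (x : A) (xs : List A) → All (λ τ → length τ ≡ suc (length xs)) (insertions x xs)
insertions-length x []       = refl ∷ []
insertions-length x (y ∷ ys) = refl ∷ map⁺ (All.map (cong suc) (insertions-length x ys))

orderings-length : {A : Set} (xs : List A) → All (λ τ → length τ ≡ length xs) (orderings xs)
orderings-length []       = refl ∷ []
orderings-length (x ∷ xs) = concat⁺ (map⁺
  (All.map (λ {τ} e → All.map (λ e' → trans e' (cong suc e)) (insertions-length x τ)) (orderings-length xs)))

#insertions : {A : Set} (x : A) (xs : List A) → length (insertions x xs) ≡ suc (length xs)
#insertions x []       = refl
#insertions x (y ∷ ys) = cong suc (trans (length-map _ (insertions x ys)) (#insertions x ys))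

#orderings : {A : Set} (xs : List A) → length (orderings xs) ≡ length xs !
#orderings []       = refl
#orderings (x ∷ xs) = begin
    length (concatMap (insertions x) (orderings xs))          ≡⟨ length≡∑ (concatMap (insertions x) (orderings xs)) ⟩
    ∑ (λ _ → 1) (concatMap (insertions x) (orderings xs))     ≡⟨ ∑-concatMap _ (insertions x) (orderings xs) ⟩
    ∑ (λ τ → ∑ (λ _ → 1) (insertions x τ)) (orderings xs)     ≡⟨ ∑-cong (All.map (λ {τ} → insertionsOf τ) (orderings-length xs)) ⟩
    ∑ (λ _ → suc (length xs)) (orderings xs)                  ≡⟨ ∑-const _ (orderings xs) ⟩
    suc (length xs) * length (orderings xs)                   ≡⟨ cong (suc (length xs) *_) (#orderings xs) ⟩
    suc (length xs) * length xs !                             ∎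
  where
  open ≡-Reasoning
  insertionsOf : ∀ τ → length τ ≡ length xs → ∑ (λ _ → 1) (insertions x τ) ≡ suc (length xs)
  insertionsOf τ e = trans (sym (length≡∑ (insertions x τ))) (trans (#insertions x τ) (cong suc e))

-- The only non-trivial case is a transposition of the first two
-- elements: inserting x and then y into σ, or y and then x, produces the
-- same multiset of lists, which `insert-comm` checks by induction on σ.

∑-insertions-∷ : {A : Set} (f : List A → ℕ) (x z : A) (zs : List A) →
  ∑ f (insertions x (z ∷ zs)) ≡ f (x ∷ z ∷ zs) + ∑ (λ ρ → f (z ∷ ρ)) (insertions x zs)
∑-insertions-∷ f x z zs = cong (f (x ∷ z ∷ zs) +_) (∑-map f (z ∷_) (insertions x zs))

insert-comm : {A : Set} (f : List A → ℕ) (x y : A) (σ : List A) →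
  ∑ (λ τ → ∑ f (insertions x τ)) (insertions y σ) ≡ ∑ (λ τ → ∑ f (insertions y τ)) (insertions x σ)
insert-comm f x y [] = solve2 (f (x ∷ y ∷ [])) (f (y ∷ x ∷ []))
  where
  solve2 : ∀ p q → p + (q + 0) + 0 ≡ q + (p + 0) + 0
  solve2 = solve-∀
insert-comm f x y (z ∷ zs) = begin
    ∑ (λ τ → ∑ f (insertions x τ)) (insertions y (z ∷ zs))
      ≡⟨ ∑-insertions-∷ (λ τ → ∑ f (insertions x τ)) y z zs ⟩
    ∑ f (insertions x (y ∷ z ∷ zs)) + ∑ (λ τ → ∑ f (insertions x (z ∷ τ))) (insertions y zs)
      ≡⟨ cong₂ _+_ (expand f x y) (expandRest f x y) ⟩
    (X + (Y + U)) + (V + ∑ (λ τ → ∑ (λ ρ → f (z ∷ ρ)) (insertions x τ)) (insertions y zs))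
      ≡⟨ cong (λ w → (X + (Y + U)) + (V + w)) (insert-comm (λ ρ → f (z ∷ ρ)) x y zs) ⟩
    (X + (Y + U)) + (V + W)
      ≡⟨ rearrange X Y U V W ⟩
    (Y + (X + V)) + (U + W)
      ≡⟨ sym (cong₂ _+_ (expand f y x) (expandRest f y x)) ⟩
    ∑ f (insertions y (x ∷ z ∷ zs)) + ∑ (λ τ → ∑ f (insertions y (z ∷ τ))) (insertions x zs)
      ≡⟨ sym (∑-insertions-∷ (λ τ → ∑ f (insertions y τ)) x z zs) ⟩
    ∑ (λ τ → ∑ f (insertions y τ)) (insertions x (z ∷ zs)) ∎
  where
  open ≡-Reasoning
  X Y U V W : ℕ
  X = f (x ∷ y ∷ z ∷ zs)
  Y = f (y ∷ x ∷ z ∷ zs)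
  U = ∑ (λ ρ → f (y ∷ z ∷ ρ)) (insertions x zs)
  V = ∑ (λ τ → f (x ∷ z ∷ τ)) (insertions y zs)
  W = ∑ (λ τ → ∑ (λ ρ → f (z ∷ ρ)) (insertions y τ)) (insertions x zs)
  expand : ∀ g p q → ∑ g (insertions p (q ∷ z ∷ zs))
         ≡ g (p ∷ q ∷ z ∷ zs) + (g (q ∷ p ∷ z ∷ zs) + ∑ (λ ρ → g (q ∷ z ∷ ρ)) (insertions p zs))
  expand g p q = trans (∑-insertions-∷ g p q (z ∷ zs))
                       (cong (g (p ∷ q ∷ z ∷ zs) +_) (∑-insertions-∷ (λ ρ → g (q ∷ ρ)) p z zs))
  expandRest : ∀ g p q → ∑ (λ τ → ∑ g (insertions p (z ∷ τ))) (insertions q zs)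
             ≡ ∑ (λ τ → g (p ∷ z ∷ τ)) (insertions q zs)
               + ∑ (λ τ → ∑ (λ ρ → g (z ∷ ρ)) (insertions p τ)) (insertions q zs)
  expandRest g p q = trans (∑-ext (λ τ → ∑-insertions-∷ g p z τ) (insertions q zs)) (∑-+ _ _ (insertions q zs))
  rearrange : ∀ a b c d e → (a + (b + c)) + (d + e) ≡ (b + (a + d)) + (c + e)
  rearrange = solve-∀

∑-orderings-↭ : {A : Set} {xs ys : List A} → xs ↭ ys → (f : List A → ℕ) →
  ∑ f (orderings xs) ≡ ∑ f (orderings ys)
∑-orderings-↭ Perm.refl f = refl
∑-orderings-↭ {xs = x ∷ xs} {ys = x ∷ ys} (Perm.prep x p) f = begin
    ∑ f (orderings (x ∷ xs))                        ≡⟨ ∑-concatMap f (insertions x) (orderings xs) ⟩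
    ∑ (λ τ → ∑ f (insertions x τ)) (orderings xs)   ≡⟨ ∑-orderings-↭ p (λ τ → ∑ f (insertions x τ)) ⟩
    ∑ (λ τ → ∑ f (insertions x τ)) (orderings ys)   ≡⟨ sym (∑-concatMap f (insertions x) (orderings ys)) ⟩
    ∑ f (orderings (x ∷ ys))                        ∎
  where open ≡-Reasoning
∑-orderings-↭ {xs = x ∷ y ∷ xs} {ys = y ∷ x ∷ ys} (Perm.swap x y p) f = begin
    ∑ f (orderings (x ∷ y ∷ xs))
      ≡⟨ twice x y xs ⟩
    ∑ (λ σ → ∑ (λ τ → ∑ f (insertions x τ)) (insertions y σ)) (orderings xs)
      ≡⟨ ∑-ext (insert-comm f x y) (orderings xs) ⟩
    ∑ (λ σ → ∑ (λ τ → ∑ f (insertions y τ)) (insertions x σ)) (orderings xs)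
      ≡⟨ ∑-orderings-↭ p _ ⟩
    ∑ (λ σ → ∑ (λ τ → ∑ f (insertions y τ)) (insertions x σ)) (orderings ys)
      ≡⟨ sym (twice y x ys) ⟩
    ∑ f (orderings (y ∷ x ∷ ys)) ∎
  where
  open ≡-Reasoning
  twice : ∀ p q zs → ∑ f (orderings (p ∷ q ∷ zs))
        ≡ ∑ (λ σ → ∑ (λ τ → ∑ f (insertions p τ)) (insertions q σ)) (orderings zs)
  twice p q zs = trans (∑-concatMap f (insertions p) (orderings (q ∷ zs)))
                       (∑-concatMap (λ τ → ∑ f (insertions p τ)) (insertions q) (orderings zs))
∑-orderings-↭ (Perm.trans p q) f = trans (∑-orderings-↭ p f) (∑-orderings-↭ q f)

-- Boolean filtering, defined by if-then-else so that it computes as soon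
-- as the value of the predicate is known.
select : {A : Set} → (A → Bool) → List A → List A
select p []       = []
select p (x ∷ xs) = if p x then x ∷ select p xs else select p xs

select-all : {A : Set} (p : A → Bool) {τ : List A} → All (λ e → p e ≡ true) τ → select p τ ≡ τ
select-all p []                    = refl
select-all p {x ∷ xs} (px ∷ pxs) rewrite px = cong (x ∷_) (select-all p pxs)

select-skip : {A : Set} (p : A → Bool) {x : A} (τ : List A) → p x ≡ false → select p (x ∷ τ) ≡ select p τ
select-skip p τ px rewrite px = refl

select-insertions : {A : Set} (p : A → Bool) (x : A) (τ : List A) → p x ≡ false →
  All (λ ρ → select p ρ ≡ select p τ) (insertions x τ)
select-insertions p x []       px = select-skip p [] px ∷ []
select-insertions p x (y ∷ ys) px =
  select-skip p (y ∷ ys) px ∷ map⁺ (All.map (cong (λ z → if p y then y ∷ z else z)) (select-insertions p x ys px))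

-- Filtering out the elements N of a list that fail p: every ordering of
-- the kept part S arises from exactly (|N| + |S|)! / |S|! orderings of N ++ S.
∑-orderings-select : {A : Set} (p : A → Bool) (f : List A → ℕ) (N S : List A) →
  All (λ e → p e ≡ false) N → All (λ e → p e ≡ true) S →
  ∑ (λ ρ → f (select p ρ)) (orderings (N ++ S)) * length S ! ≡ length (N ++ S) ! * ∑ f (orderings S)
∑-orderings-select p f [] S [] pS =
  trans (cong (_* length S !) (∑-cong (All.map (λ pτ → cong f (select-all p pτ)) (orderings-All pS))))
        (*-comm _ (length S !))
∑-orderings-select p f (e ∷ N) S (pe ∷ pN) pS = begin
    ∑ g (concatMap (insertions e) (orderings (N ++ S))) * length S !
      ≡⟨ cong (_* length S !) (∑-concatMap g (insertions e) (orderings (N ++ S))) ⟩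
    ∑ (λ τ → ∑ g (insertions e τ)) (orderings (N ++ S)) * length S !
      ≡⟨ cong (_* length S !) (∑-cong (All.map (λ {τ} → viaInsertion τ) (orderings-length (N ++ S)))) ⟩
    ∑ (λ τ → L * g τ) (orderings (N ++ S)) * length S !
      ≡⟨ cong (_* length S !) (∑-*ˡ L g (orderings (N ++ S))) ⟩
    L * ∑ g (orderings (N ++ S)) * length S !
      ≡⟨ *-assoc L (∑ g (orderings (N ++ S))) (length S !) ⟩
    L * (∑ g (orderings (N ++ S)) * length S !)
      ≡⟨ cong (L *_) (∑-orderings-select p f N S pN pS) ⟩
    L * (length (N ++ S) ! * ∑ f (orderings S))
      ≡⟨ sym (*-assoc L (length (N ++ S) !) (∑ f (orderings S))) ⟩
    L ! * ∑ f (orderings S) ∎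
  where
  open ≡-Reasoning
  g : List _ → ℕ
  g ρ = f (select p ρ)
  L : ℕ
  L = suc (length (N ++ S))
  -- inserting e does not change the filtered list, and there are L places
  viaInsertion : ∀ τ → length τ ≡ length (N ++ S) → ∑ g (insertions e τ) ≡ L * g τ
  viaInsertion τ lτ = begin
      ∑ g (insertions e τ)                ≡⟨ ∑-cong (All.map (cong f) (select-insertions p e τ pe)) ⟩
      ∑ (λ _ → g τ) (insertions e τ)      ≡⟨ ∑-const (g τ) (insertions e τ) ⟩
      g τ * length (insertions e τ)       ≡⟨ cong (g τ *_) (trans (#insertions e τ) (cong suc lτ)) ⟩
      g τ * L                             ≡⟨ *-comm (g τ) L ⟩
      L * g τ                             ∎

startsWith : {A : Set} → (A → Bool) → List A → Bool
startsWith q []      = false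
startsWith q (x ∷ _) = q x

#startsWith : {A : Set} (q : A → Bool) (b : A) (R : List A) →
  q b ≡ true → All (λ r → q r ≡ false) R →
  ∑ (λ ρ → χ (startsWith q ρ)) (orderings (b ∷ R)) ≡ length R !
#startsWith q b R qb qR = begin
    ∑ h (concatMap (insertions b) (orderings R))      ≡⟨ ∑-concatMap h (insertions b) (orderings R) ⟩
    ∑ (λ μ → ∑ h (insertions b μ)) (orderings R)      ≡⟨ ∑-cong (All.map (λ {μ} → onlyAtFront μ) (orderings-All qR)) ⟩
    ∑ (λ _ → 1) (orderings R)                         ≡⟨ sym (length≡∑ (orderings R)) ⟩
    length (orderings R)                              ≡⟨ #orderings R ⟩
    length R !                                        ∎
  where
  open ≡-Reasoning
  h : List _ → ℕ
  h ρ = χ (startsWith q ρ)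
  onlyAtFront : ∀ μ → All (λ r → q r ≡ false) μ → ∑ h (insertions b μ) ≡ 1
  onlyAtFront []       _        rewrite qb = refl
  onlyAtFront (m ∷ ms) (qm ∷ _) rewrite qb =
    cong suc (trans (∑-map h (m ∷_) (insertions b ms)) (∑-zero _ (insertions b ms) (λ _ → cong χ qm)))

-- If the orderings of a ∷ b ∷ R must start with a (tested by qa), and the
-- subsequence of w-elements (which is b ∷ R, rearranged) must start with b
-- (tested by qb), then exactly |R|! of them qualify: those starting a, b.
#startsWith₂ : {A : Set} (w qa qb : A → Bool) (a b : A) (R : List A) →
  w a ≡ false → w b ≡ true → All (λ r → w r ≡ true) R →
  qa a ≡ true → qa b ≡ false → All (λ r → qa r ≡ false) R →
  qb b ≡ true → All (λ r → qb r ≡ false) R →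
  ∑ (λ τ → χ (startsWith qa τ ∧ startsWith qb (select w τ))) (orderings (a ∷ b ∷ R)) ≡ length R !
#startsWith₂ w qa qb a b R wa wb wR qaa qab qaR qbb qbR = begin
    ∑ h (concatMap (insertions a) (orderings (b ∷ R)))
      ≡⟨ ∑-concatMap h (insertions a) (orderings (b ∷ R)) ⟩
    ∑ (λ ρ → ∑ h (insertions a ρ)) (orderings (b ∷ R))
      ≡⟨ ∑-cong (All.map (λ {ρ} → insertA ρ) (orderings-All ((wb , qab) ∷ All.zip (wR , qaR)))) ⟩
    ∑ (λ ρ → χ (startsWith qb ρ)) (orderings (b ∷ R))
      ≡⟨ #startsWith qb b R qbb qbR ⟩
    length R ! ∎
  where
  open ≡-Reasoning
  h : List _ → ℕ
  h τ = χ (startsWith qa τ ∧ startsWith qb (select w τ))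
  -- among the insertions of a into ρ only the one at the front starts with a
  insertA : ∀ ρ → All (λ r → w r ≡ true × qa r ≡ false) ρ → ∑ h (insertions a ρ) ≡ χ (startsWith qb ρ)
  insertA []       _                rewrite qaa | wa = refl
  insertA (m ∷ ms) ((wm , qam) ∷ _) rewrite qaa | wa | wm =
    trans (cong (χ (qb m) +_) (trans (∑-map h (m ∷_) (insertions a ms))
                                      (∑-zero _ (insertions a ms) (λ τ → cong (λ z → χ (z ∧ _)) qam))))
          (+-identityʳ _)

≡ᵇ-refl : (n : ℕ) → (n ≡ᵇ n) ≡ true
≡ᵇ-refl n = Equivalence.to T-≡ (≡⇒≡ᵇ n n refl)

≡ᵇ-true : (m n : ℕ) → (m ≡ᵇ n) ≡ true → m ≡ n
≡ᵇ-true m n e = ≡ᵇ⇒≡ m n (Equivalence.from T-≡ e)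

≡ᵇ-false : (m n : ℕ) → m ≢ n → (m ≡ᵇ n) ≡ false
≡ᵇ-false m n m≢n with m ≡ᵇ n in e
... | true  = ⊥-elim (m≢n (≡ᵇ-true m n e))
... | false = refl

≡ᵇ-false⁻ : (m n : ℕ) → (m ≡ᵇ n) ≡ false → m ≢ n
≡ᵇ-false⁻ m n e refl with trans (sym (≡ᵇ-refl m)) e
... | ()

∨-true : (a b : Bool) → (a ∨ b) ≡ true → (a ≡ true) ⊎ (b ≡ true)
∨-true true  b e = inj₁ refl
∨-true false b e = inj₂ e

elem-sound : ∀ {v} xs → elem v xs ≡ true → v ∈ xs
elem-sound {v} (x ∷ xs) e with ∨-true (v ≡ᵇ x) (elem v xs) e
... | inj₁ v≡x = here (≡ᵇ-true v x v≡x)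
... | inj₂ v∈xs = there (elem-sound xs v∈xs)

elem-complete : ∀ {v xs} → v ∈ xs → elem v xs ≡ true
elem-complete {v} (here refl) rewrite ≡ᵇ-refl v = refl
elem-complete {v} {x ∷ _} (there v∈xs) rewrite elem-complete v∈xs = ∨-zeroʳ (v ≡ᵇ x)

elem-∉ : ∀ {v} xs → v ∉ xs → elem v xs ≡ false
elem-∉ {v} xs v∉xs with elem v xs in e
... | true  = ⊥-elim (v∉xs (elem-sound xs e))
... | false = refl

∉-elem : ∀ {v xs} → elem v xs ≡ false → v ∉ xs
∉-elem e v∈xs with trans (sym (elem-complete v∈xs)) e
... | ()

centre≢leaf : ∀ {c v} → c < 2 → 2 ≤ v → c ≢ v
centre≢leaf c<2 2≤v refl = <-irrefl refl (<-≤-trans c<2 2≤v)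

New : List ℕ → Edge → Set
New seen (x , y) = x ∉ seen ⊎ y ∉ seen

new⇒fresh : ∀ seen x y → New seen (x , y) → (not (elem x seen) ∨ not (elem y seen)) ≡ true
new⇒fresh seen x y (inj₁ x∉) rewrite elem-∉ seen x∉ = refl
new⇒fresh seen x y (inj₂ y∉) rewrite elem-∉ seen y∉ = ∨-zeroʳ (not (elem x seen))

fresh⇒new : ∀ seen x y → (not (elem x seen) ∨ not (elem y seen)) ≡ true → New seen (x , y)
fresh⇒new seen x y e with ∨-true _ _ e
... | inj₁ nx = inj₁ (∉-elem (not-injective nx))
... | inj₂ ny = inj₂ (∉-elem (not-injective ny))

forest-keep : ∀ seen x y es → New seen (x , y) → (x , y) ∈ forestFrom seen ((x , y) ∷ es)
forest-keep seen x y es new rewrite new⇒fresh seen x y new = here refl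

forest-later : ∀ seen x y es {e} → e ∈ forestFrom (x ∷ y ∷ seen) es → e ∈ forestFrom seen ((x , y) ∷ es)
forest-later seen x y es m with not (elem x seen) ∨ not (elem y seen)
... | true  = there m
... | false = m

forest-step : ∀ seen x y es {e} → e ∈ forestFrom seen ((x , y) ∷ es) →
  (e ≡ (x , y) × New seen (x , y)) ⊎ e ∈ forestFrom (x ∷ y ∷ seen) es
forest-step seen x y es m with not (elem x seen) ∨ not (elem y seen) in fresh
forest-step seen x y es (here refl) | true  = inj₁ (refl , fresh⇒new seen x y fresh)
forest-step seen x y es (there m)   | true  = inj₂ m
forest-step seen x y es m           | false = inj₂ m

forest-⊆ : ∀ seen es {e} → e ∈ forestFrom seen es → e ∈ es
forest-⊆ seen ((x , y) ∷ es) m with forest-step seen x y es m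
... | inj₁ (refl , _) = here refl
... | inj₂ m'         = there (forest-⊆ (x ∷ y ∷ seen) es m')

-- In an ordering of centre–leaf edges, every leaf not yet seen keeps an
-- edge: its first edge is kept because the leaf is new there.
forest-covers : ∀ seen es {v} → v ∉ seen → All (λ e → proj₁ e < 2) es → 2 ≤ v →
  (∃[ e ] e ∈ es × proj₂ e ≡ v) → ∃[ e ] e ∈ forestFrom seen es × proj₂ e ≡ v
forest-covers seen ((x , y) ∷ es) v∉ (x<2 ∷ _) _ (_ , here refl , refl) =
  (x , y) , forest-keep seen x y es (inj₂ v∉) , refl
forest-covers seen ((x , y) ∷ es) {v} v∉ (x<2 ∷ cs) 2≤v (e , there e∈ , e↦v) with y ≟ v
... | yes refl = (x , y) , forest-keep seen x y es (inj₂ v∉) , refl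
... | no y≢v with forest-covers (x ∷ y ∷ seen) es v∉' cs 2≤v (e , e∈ , e↦v)
  where
  v∉' : v ∉ x ∷ y ∷ seen
  v∉' (here v≡x)          = centre≢leaf x<2 2≤v (sym v≡x)
  v∉' (there (here v≡y))  = y≢v (sym v≡y)
  v∉' (there (there v∈))  = v∉ v∈
...   | e' , m , e'↦v = e' , forest-later seen x y es m , e'↦v

centres-seen : ∀ {seen : List ℕ} {x y : ℕ} {es : List Edge} →
  All (λ e → proj₁ e ∈ seen) es → All (λ e → proj₁ e ∈ x ∷ y ∷ seen) es
centres-seen = All.map (λ c∈ → there (there c∈))

-- Once the centre of every remaining edge has been seen, a kept edge
-- always has a new leaf; consequently no leaf can gain two kept edges.
kept-leaf-new : ∀ seen es → All (λ e → proj₁ e ∈ seen) es →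
  ∀ {e} → e ∈ forestFrom seen es → proj₂ e ∉ seen
kept-leaf-new seen ((x , y) ∷ es) (x∈ ∷ cs) m with forest-step seen x y es m
... | inj₁ (refl , inj₁ x∉) = ⊥-elim (x∉ x∈)
... | inj₁ (refl , inj₂ y∉) = y∉
... | inj₂ m' = λ v∈ → kept-leaf-new (x ∷ y ∷ seen) es (centres-seen cs) m' (there (there v∈))

no-late-shared-leaf : ∀ seen es → All (λ e → proj₁ e ∈ seen) es →
  ∀ {c c' z} → c ≢ c' → (c , z) ∈ forestFrom seen es → (c' , z) ∉ forestFrom seen es
no-late-shared-leaf seen ((x , y) ∷ es) (x∈ ∷ cs) c≢c' m m'
  with forest-step seen x y es m | forest-step seen x y es m'
... | inj₁ (refl , _) | inj₁ (refl , _) = c≢c' refl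
... | inj₁ (refl , _) | inj₂ n'         = kept-leaf-new (x ∷ y ∷ seen) es (centres-seen cs) n' (there (here refl))
... | inj₂ n          | inj₁ (refl , _) = kept-leaf-new (x ∷ y ∷ seen) es (centres-seen cs) n (there (here refl))
... | inj₂ n          | inj₂ n'         = no-late-shared-leaf (x ∷ y ∷ seen) es (centres-seen cs) c≢c' n n'

-- The scan deciding whether the forest of an ordering of centre–leaf
-- edges has a leaf joined to both centres.  While all edges are at the
-- first centre c, their leaves are collected in S; the first edge at the
-- other centre decides: the two stars meet iff its leaf is in S.
crossesFrom : ℕ → List ℕ → List Edge → Bool
crossesFrom c S []             = false
crossesFrom c S ((d , y) ∷ es) = if d ≡ᵇ c then crossesFrom c (y ∷ S) es else elem y S

crosses : List Edge → Bool
crosses []             = false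
crosses ((d , y) ∷ es) = crossesFrom d (y ∷ []) es

crossesFrom-same : ∀ c S y es → crossesFrom c S ((c , y) ∷ es) ≡ crossesFrom c (y ∷ S) es
crossesFrom-same c S y es rewrite ≡ᵇ-refl c = refl

crossesFrom-other : ∀ {c c'} S y es → c' ≢ c → crossesFrom c S ((c' , y) ∷ es) ≡ elem y S
crossesFrom-other {c} {c'} S y es c'≢c rewrite ≡ᵇ-false c' c c'≢c = refl

module TwoCentres (c c' : ℕ) (c<2 : c < 2) (c'<2 : c' < 2) (c≢c' : c ≢ c') where

  c'≢c : c' ≢ c
  c'≢c e = c≢c' (sym e)

  Spoke : Edge → Set
  Spoke e = (proj₁ e ≡ c ⊎ proj₁ e ≡ c') × 2 ≤ proj₂ e

  c'∉-after : ∀ {seen y} → c' ∉ seen → 2 ≤ y → c' ∉ c ∷ y ∷ seen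
  c'∉-after c'∉ 2≤y (here e)                = c'≢c e
  c'∉-after c'∉ 2≤y (there (here e))        = centre≢leaf c'<2 2≤y e
  c'∉-after c'∉ 2≤y (there (there c'∈))    = c'∉ c'∈

  scan-true : ∀ seen S es → c' ∉ seen → (∀ y → 2 ≤ y → y ∈ seen → y ∈ S) → All Spoke es →
    crossesFrom c S es ≡ true →
    ∃[ z ] (c' , z) ∈ forestFrom seen es × (z ∈ S ⊎ (c , z) ∈ forestFrom seen es)
  scan-true seen S ((_ , y) ∷ es) c'∉ S⊇ ((inj₁ refl , 2≤y) ∷ ss) scan
    with scan-true (c ∷ y ∷ seen) (y ∷ S) es (c'∉-after c'∉ 2≤y) S⊇' ss
           (trans (sym (crossesFrom-same c S y es)) scan)
    where
    S⊇' : ∀ v → 2 ≤ v → v ∈ c ∷ y ∷ seen → v ∈ y ∷ S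
    S⊇' v 2≤v (here v≡c)          = ⊥-elim (centre≢leaf c<2 2≤v (sym v≡c))
    S⊇' v 2≤v (there (here v≡y))  = here v≡y
    S⊇' v 2≤v (there (there v∈))  = there (S⊇ v 2≤v v∈)
  ... | z , m , inj₂ m'            = z , forest-later seen c y es m , inj₂ (forest-later seen c y es m')
  ... | z , m , inj₁ (there z∈S)   = z , forest-later seen c y es m , inj₁ z∈S
  ... | z , m , inj₁ (here refl)   = z , forest-later seen c z es m , viaLeaf (elem z seen) refl
    where
    viaLeaf : ∀ b → elem z seen ≡ b → z ∈ S ⊎ (c , z) ∈ forestFrom seen ((c , z) ∷ es)
    viaLeaf true  e = inj₁ (S⊇ z 2≤y (elem-sound seen e))
    viaLeaf false e = inj₂ (forest-keep seen c z es (inj₂ (∉-elem e)))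
  scan-true seen S ((_ , y) ∷ es) c'∉ S⊇ ((inj₂ refl , 2≤y) ∷ ss) scan =
    y , forest-keep seen c' y es (inj₁ c'∉) , inj₁ (elem-sound S (trans (sym (crossesFrom-other S y es c'≢c)) scan))

  scan-false : ∀ seen S es → c' ∉ seen → c ∈ seen → (∀ y → y ∈ S → y ∈ seen) → All Spoke es →
    crossesFrom c S es ≡ false →
    ∀ {z} → (c' , z) ∈ forestFrom seen es → z ∉ S × (c , z) ∉ forestFrom seen es
  scan-false seen S ((_ , y) ∷ es) c'∉ c∈ S⊆ ((inj₁ refl , 2≤y) ∷ ss) scan m
    with forest-step seen c y es m
  ... | inj₁ (e , _) = ⊥-elim (c'≢c (cong proj₁ e))
  ... | inj₂ m' with scan-false (c ∷ y ∷ seen) (y ∷ S) es (c'∉-after c'∉ 2≤y) (here refl) S⊆' ss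
                      (trans (sym (crossesFrom-same c S y es)) scan) m'
    where
    S⊆' : ∀ v → v ∈ y ∷ S → v ∈ c ∷ y ∷ seen
    S⊆' v (here v≡y) = there (here v≡y)
    S⊆' v (there v∈) = there (there (S⊆ v v∈))
  ...   | z∉yS , notJoined' = (λ z∈S → z∉yS (there z∈S)) , notJoined
    where
    notJoined : (c , _) ∉ forestFrom seen ((c , y) ∷ es)
    notJoined n with forest-step seen c y es n
    ... | inj₁ (e , _) = z∉yS (here (cong proj₂ e))
    ... | inj₂ n'      = notJoined' n'
  scan-false seen S ((_ , y) ∷ es) c'∉ c∈ S⊆ ((inj₂ refl , 2≤y) ∷ ss) scan {z} m =
    leafNotInS , notJoined
    where
    y∉S : y ∉ S
    y∉S = ∉-elem (trans (sym (crossesFrom-other S y es c'≢c)) scan)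
    centresSeen : All (λ e → proj₁ e ∈ c' ∷ y ∷ seen) es
    centresSeen = All.map (λ { (inj₁ refl , _) → there (there c∈) ; (inj₂ refl , _) → here refl }) ss
    leafNotInS : z ∉ S
    leafNotInS with forest-step seen c' y es m
    ... | inj₁ (e , _) = subst (_∉ S) (sym (cong proj₂ e)) y∉S
    ... | inj₂ m'      = λ z∈S → kept-leaf-new (c' ∷ y ∷ seen) es centresSeen m' (there (there (S⊆ z z∈S)))
    notJoined : (c , z) ∉ forestFrom seen ((c' , y) ∷ es)
    notJoined n with forest-step seen c' y es n | forest-step seen c' y es m
    ... | inj₁ (e , _) | _                  = c≢c' (cong proj₁ e)
    ... | inj₂ n'      | inj₁ (e , _)       =
      kept-leaf-new (c' ∷ y ∷ seen) es centresSeen n' (there (here (cong proj₂ e)))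
    ... | inj₂ n'      | inj₂ m'            = no-late-shared-leaf (c' ∷ y ∷ seen) es centresSeen c≢c' n' m'

  from-c-shared : ∀ y₀ es → 2 ≤ y₀ → All Spoke es → crossesFrom c (y₀ ∷ []) es ≡ true →
    ∃[ z ] (c , z) ∈ forest ((c , y₀) ∷ es) × (c' , z) ∈ forest ((c , y₀) ∷ es)
  from-c-shared y₀ es 2≤y₀ ss scan with scan-true [] [] ((c , y₀) ∷ es) (λ ()) (λ _ _ ())
                                      ((inj₁ refl , 2≤y₀) ∷ ss) (trans (crossesFrom-same c [] y₀ es) scan)
  ... | z , m , inj₂ m' = z , m' , m

  from-c-separate : ∀ y₀ es → 2 ≤ y₀ → All Spoke es → crossesFrom c (y₀ ∷ []) es ≡ false →
    ∀ {z} → (c , z) ∈ forest ((c , y₀) ∷ es) → (c' , z) ∉ forest ((c , y₀) ∷ es)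
  from-c-separate y₀ es 2≤y₀ ss scan {z} m m' with forest-step [] c y₀ es m'
  ... | inj₁ (e , _) = c'≢c (cong proj₁ e)
  ... | inj₂ n' with scan-false (c ∷ y₀ ∷ []) (y₀ ∷ []) es (c'∉-after (λ ()) 2≤y₀) (here refl)
                       (λ { v (here refl) → there (here refl) }) ss scan n'
  ...   | z∉ , notJoined with forest-step [] c y₀ es m
  ...     | inj₁ (e , _) = z∉ (here (cong proj₂ e))
  ...     | inj₂ n       = notJoined n

CentreLeaf : Edge → Set
CentreLeaf e = proj₁ e < 2 × 2 ≤ proj₂ e

module Scan01 = TwoCentres 0 1 (s≤s z≤n) (s≤s (s≤s z≤n)) (λ ())
module Scan10 = TwoCentres 1 0 (s≤s (s≤s z≤n)) (s≤s z≤n) (λ ())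

spoke01 : ∀ {e} → CentreLeaf e → Scan01.Spoke e
spoke01 {0 , _}           (_ , 2≤) = inj₁ refl , 2≤
spoke01 {1 , _}           (_ , 2≤) = inj₂ refl , 2≤
spoke01 {suc (suc _) , _} (s≤s (s≤s ()) , _)

spoke10 : ∀ {e} → CentreLeaf e → Scan10.Spoke e
spoke10 {0 , _}           (_ , 2≤) = inj₂ refl , 2≤
spoke10 {1 , _}           (_ , 2≤) = inj₁ refl , 2≤
spoke10 {suc (suc _) , _} (s≤s (s≤s ()) , _)

crosses⇒shared : ∀ σ → All CentreLeaf σ → crosses σ ≡ true →
  ∃[ z ] (0 , z) ∈ forest σ × (1 , z) ∈ forest σ
crosses⇒shared ((0 , y) ∷ es) ((_ , 2≤y) ∷ ss) scan = Scan01.from-c-shared y es 2≤y (All.map spoke01 ss) scan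
crosses⇒shared ((1 , y) ∷ es) ((_ , 2≤y) ∷ ss) scan with Scan10.from-c-shared y es 2≤y (All.map spoke10 ss) scan
... | z , m₁ , m₀ = z , m₀ , m₁
crosses⇒shared ((suc (suc _) , _) ∷ _) ((s≤s (s≤s ()) , _) ∷ _) _

noCrossing⇒separate : ∀ σ → All CentreLeaf σ → crosses σ ≡ false →
  ∀ {z} → (0 , z) ∈ forest σ → (1 , z) ∉ forest σ
noCrossing⇒separate ((0 , y) ∷ es) ((_ , 2≤y) ∷ ss) scan m₀ m₁ = Scan01.from-c-separate y es 2≤y (All.map spoke01 ss) scan m₀ m₁
noCrossing⇒separate ((1 , y) ∷ es) ((_ , 2≤y) ∷ ss) scan m₀ m₁ = Scan10.from-c-separate y es 2≤y (All.map spoke10 ss) scan m₁ m₀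
noCrossing⇒separate ((suc (suc _) , _) ∷ _) ((s≤s (s≤s ()) , _) ∷ _) _

any-intro : {A : Set} (f : A → Bool) {x : A} {xs : List A} → x ∈ xs → f x ≡ true → any f xs ≡ true
any-intro f {xs = y ∷ ys} (here refl) e rewrite e = refl
any-intro f {xs = y ∷ ys} (there m)   e rewrite any-intro f m e = ∨-zeroʳ (f y)

any-elim : {A : Set} (f : A → Bool) (xs : List A) → any f xs ≡ true → ∃[ x ] x ∈ xs × f x ≡ true
any-elim f (y ∷ ys) e with ∨-true (f y) _ e
... | inj₁ fy = y , here refl , fy
... | inj₂ e' with any-elim f ys e'
...   | x , m , fx = x , there m , fx

any-false : {A : Set} (f : A → Bool) (xs : List A) → All (λ x → f x ≡ false) xs → any f xs ≡ false
any-false f []       []       = refl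
any-false f (y ∷ ys) (p ∷ ps) rewrite p = any-false f ys ps

adjacent-intro : ∀ F {x y} → (x , y) ∈ F ⊎ (y , x) ∈ F → adjacent F x y ≡ true
adjacent-intro F {x} {y} (inj₁ m) = any-intro _ m (≡-both x y)
  where
  ≡-both : ∀ x y → (((x ≡ᵇ x) ∧ (y ≡ᵇ y)) ∨ ((x ≡ᵇ y) ∧ (y ≡ᵇ x))) ≡ true
  ≡-both x y rewrite ≡ᵇ-refl x | ≡ᵇ-refl y = refl
adjacent-intro F {x} {y} (inj₂ m) = any-intro _ m (≡-swapped y x)
  where
  ≡-swapped : ∀ y x → (((y ≡ᵇ x) ∧ (x ≡ᵇ y)) ∨ ((y ≡ᵇ y) ∧ (x ≡ᵇ x))) ≡ true
  ≡-swapped y x rewrite ≡ᵇ-refl x | ≡ᵇ-refl y = ∨-zeroʳ _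

adjacent-elim : ∀ F u v → adjacent F u v ≡ true → (u , v) ∈ F ⊎ (v , u) ∈ F
adjacent-elim F u v e with any-elim _ F e
... | (x , y) , m , h with ∨-true _ _ h
...   | inj₁ h₁ with ≡ᵇ-true x u (∧-conicalˡ _ _ h₁) | ≡ᵇ-true y v (∧-conicalʳ _ _ h₁)
...     | refl | refl = inj₁ m
adjacent-elim F u v e | (x , y) , m , h | inj₂ h₂ with ≡ᵇ-true x v (∧-conicalˡ _ _ h₂) | ≡ᵇ-true y u (∧-conicalʳ _ _ h₂)
...     | refl | refl = inj₂ m

reach-refl : ∀ V F n v → reachW V F n v v ≡ true
reach-refl V F zero    v = ≡ᵇ-refl v
reach-refl V F (suc n) v rewrite reach-refl V F n v = refl

reach-step : ∀ V F n {v u w} → u ∈ V → reachW V F n v u ≡ true → adjacent F u w ≡ true →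
  reachW V F (suc n) v w ≡ true
reach-step V F n {v} {u} {w} u∈V r a =
  trans (cong (reachW V F n v w ∨_) (any-intro (λ u → reachW V F n v u ∧ adjacent F u w) u∈V (r∧a r a)))
        (∨-zeroʳ _)
  where
  r∧a : ∀ {p q} → p ≡ true → q ≡ true → (p ∧ q) ≡ true
  r∧a refl refl = refl

reach-from-1 : ∀ V F → All CentreLeaf F → (∀ {z} → (0 , z) ∈ F → (1 , z) ∉ F) →
  ∀ n v → reachW V F n 1 v ≡ true → v ≡ 1 ⊎ (1 , v) ∈ F
reach-from-1 V F shape separate zero    v r = inj₁ (sym (≡ᵇ-true 1 v r))
reach-from-1 V F shape separate (suc n) v r with ∨-true _ _ r
... | inj₁ r' = reach-from-1 V F shape separate n v r'
... | inj₂ r' with any-elim _ V r'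
...   | u , _ , h with reach-from-1 V F shape separate n u (∧-conicalˡ _ _ h) | adjacent-elim F u v (∧-conicalʳ _ _ h)
...     | inj₁ refl | inj₁ m = inj₂ m
...     | inj₁ refl | inj₂ m = ⊥-elim (centre≢leaf (s≤s (s≤s z≤n)) (proj₂ (All.lookup shape m)) refl)
...     | inj₂ m₁   | inj₁ m = ⊥-elim (centre≢leaf (proj₁ (All.lookup shape m)) (proj₂ (All.lookup shape m₁)) refl)
...     | inj₂ m₁   | inj₂ m = backToCentre v m (proj₁ (All.lookup shape m))
  where
  backToCentre : ∀ v → (v , u) ∈ F → v < 2 → v ≡ 1 ⊎ (1 , v) ∈ F
  backToCentre zero          m₀ _ = ⊥-elim (separate m₀ m₁)
  backToCentre (suc zero)    _  _ = inj₁ refl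
  backToCentre (suc (suc _)) _  (s≤s (s≤s ()))

module TwoStars (L : List ℕ) (F : List Edge) (shape : All CentreLeaf F)
                (leaves : All (2 ≤_) L) (attached : ∀ {v} → v ∈ L → ∃[ d ] d < 2 × (d , v) ∈ F) where

  V : List ℕ
  V = 0 ∷ 1 ∷ L

  disconnected : (∀ {z} → (0 , z) ∈ F → (1 , z) ∉ F) → connected V F 1 0 ≡ false
  disconnected separate with connected V F 1 0 in r
  ... | false = refl
  ... | true with reach-from-1 V F shape separate (length V) 0 r
  ...   | inj₂ m = ⊥-elim (centre≢leaf (s≤s z≤n) (proj₂ (All.lookup shape m)) refl)

  connected-via : ∀ {z} → z ∈ L → (0 , z) ∈ F → (1 , z) ∈ F → connected V F 1 0 ≡ true
  connected-via z∈L m₀ m₁ =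
    reach-step V F (suc (length L)) (there (there z∈L))
      (reach-step V F (length L) (there (here refl)) (reach-refl V F (length L) 1) (adjacent-intro F (inj₁ m₁)))
      (adjacent-intro F (inj₂ m₀))

  -- Each component is counted at its least vertex: 0 always, 1 iff it is
  -- not connected to 0, and never a leaf, which is connected to a smaller
  -- centre.
  smaller-connected : ℕ → Bool
  smaller-connected v = any (λ w → (w <ᵇ v) ∧ connected V F v w) V

  at0 : smaller-connected 0 ≡ false
  at0 = any-false _ V (All.tabulate (λ _ → refl))

  at1 : smaller-connected 1 ≡ connected V F 1 0
  at1 = trans (cong (λ b → connected V F 1 0 ∨ b) (any-false (λ w → (w <ᵇ 1) ∧ connected V F 1 w) L
                   (All.map (λ { (s≤s (s≤s _)) → refl }) leaves)))
              (∨-identityʳ _)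

  atLeaf : ∀ {v} → v ∈ L → not (smaller-connected v) ≡ false
  atLeaf {v} v∈L with attached v∈L | All.lookup leaves v∈L
  ... | d , d<2 , m | 2≤v =
    cong not (any-intro (λ w → (w <ᵇ v) ∧ connected V F v w) (centre∈V d d<2) (d<v∧connected (centre<leaf d<2 2≤v)))
    where
    centre∈V : ∀ d → d < 2 → d ∈ V
    centre∈V zero          _ = here refl
    centre∈V (suc zero)    _ = there (here refl)
    centre∈V (suc (suc _)) (s≤s (s≤s ()))
    centre<leaf : d < 2 → 2 ≤ v → (d <ᵇ v) ≡ true
    centre<leaf d<2 2≤v = Equivalence.to T-≡ (<⇒<ᵇ (<-≤-trans d<2 2≤v))
    d<v∧connected : (d <ᵇ v) ≡ true → ((d <ᵇ v) ∧ connected V F v d) ≡ true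
    d<v∧connected d<v rewrite d<v =
      reach-step V F (suc (length L)) (there (there v∈L)) (reach-refl V F (suc (length L)) v) (adjacent-intro F (inj₂ m))

  numComponents≡ : numComponents V F ≡ (if connected V F 1 0 then 1 else 2)
  numComponents≡ rewrite at0 | at1 | count-none _ L (All.tabulate atLeaf) with connected V F 1 0
  ... | true  = refl
  ... | false = refl

numComponents-forest : ∀ L σ → All CentreLeaf σ → All (2 ≤_) L → All (λ e → proj₂ e ∈ L) σ →
  (∀ {v} → v ∈ L → ∃[ e ] e ∈ σ × proj₂ e ≡ v) →
  numComponents (0 ∷ 1 ∷ L) (forest σ) ≡ (if crosses σ then 1 else 2)
numComponents-forest L σ shape leaves inL covered =
  trans Stars.numComponents≡ (cong (λ b → if b then 1 else 2) connected≡crosses)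
  where
  kept : ∀ {e} → e ∈ forest σ → e ∈ σ
  kept = forest-⊆ [] σ
  attached : ∀ {v} → v ∈ L → ∃[ d ] d < 2 × (d , v) ∈ forest σ
  attached v∈L with forest-covers [] σ (λ ()) (All.map proj₁ shape) (All.lookup leaves v∈L) (covered v∈L)
  ... | e , m , refl = proj₁ e , proj₁ (All.lookup shape (kept m)) , m
  module Stars = TwoStars L (forest σ) (All.tabulate (λ m → All.lookup shape (kept m))) leaves attached
  connected≡crosses : connected (0 ∷ 1 ∷ L) (forest σ) 1 0 ≡ crosses σ
  connected≡crosses with crosses σ in scan
  ... | true with crosses⇒shared σ shape scan
  ...   | z , m₀ , m₁ = Stars.connected-via (All.lookup inL (kept m₀)) m₀ m₁
  connected≡crosses | false = Stars.disconnected (noCrossing⇒separate σ shape scan)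

sameEdge : Edge → Edge → Bool
sameEdge (x , y) (x' , y') = (x ≡ᵇ x') ∧ (y ≡ᵇ y')

atCentre : ℕ → Edge → Bool
atCentre c e = proj₁ e ≡ᵇ c

-- The event that the stars meet at the leaf x with c the first centre:
-- (c , x) precedes every edge at c', and the first edge at c' is (c' , x).
meetsAt : ℕ → ℕ → ℕ → List Edge → Bool
meetsAt c c' x σ = startsWith (sameEdge (c , x)) (select (λ e → sameEdge e (c , x) ∨ atCentre c' e) σ)
                 ∧ startsWith (sameEdge (c' , x)) (select (atCentre c') σ)

∑-at : (f : ℕ → Bool) (y : ℕ) (B : List ℕ) →
  ∑ (λ x → χ (f x ∧ (x ≡ᵇ y))) B ≡ χ (f y) * ∑ (λ x → χ (x ≡ᵇ y)) B
∑-at f y B = trans (∑-ext pointwise B) (∑-*ˡ (χ (f y)) (λ x → χ (x ≡ᵇ y)) B)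
  where
  pointwise : ∀ x → χ (f x ∧ (x ≡ᵇ y)) ≡ χ (f y) * χ (x ≡ᵇ y)
  pointwise x with x ≡ᵇ y in e
  ... | true  rewrite ≡ᵇ-true x y e = trans (cong χ (∧-identityʳ (f y))) (sym (*-identityʳ (χ (f y))))
  ... | false = trans (cong χ (∧-zeroʳ (f x))) (sym (*-zeroʳ (χ (f y))))

-- The scan is the disjoint union of the events meetsAt over the leaves
-- shared by the two centres.  `meetsFrom x S es` is the event that the
-- stars meet at x, given that the scan has so far collected the leaves S
-- at c.  `once` says each shared leaf occurs exactly once in B.
module Decomposition (B : List ℕ) (c c' : ℕ) (c≢c' : c ≢ c') (Rc Rc' : ℕ → Set)
                     (once : ∀ y → Rc y → Rc' y → ∑ (λ x → χ (x ≡ᵇ y)) B ≡ 1) where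

  Spoke : Edge → Set
  Spoke e = (proj₁ e ≡ c × Rc (proj₂ e)) ⊎ (proj₁ e ≡ c' × Rc' (proj₂ e))

  meetsFrom : ℕ → List ℕ → List Edge → Bool
  meetsFrom x S es = if elem x S then startsWith (sameEdge (c' , x)) (select (atCentre c') es) else meetsAt c c' x es

  meetsFrom-same : ∀ x S y es → meetsFrom x S ((c , y) ∷ es) ≡ meetsFrom x (y ∷ S) es
  meetsFrom-same x S y es with elem x S in eS
  ... | true rewrite ∨-zeroʳ (x ≡ᵇ y) | ≡ᵇ-false c c' c≢c' = refl
  ... | false with x ≡ᵇ y in exy
  ...   | true rewrite sym (≡ᵇ-true x y exy) | ≡ᵇ-refl c | ≡ᵇ-refl x | ≡ᵇ-false c c' c≢c' | ≡ᵇ-refl c | ≡ᵇ-refl x = refl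
  ...   | false rewrite ≡ᵇ-refl c | ≡ᵇ-false c c' c≢c' | ≡ᵇ-false y x (λ e → ≡ᵇ-false⁻ x y exy (sym e)) = refl

  meetsFrom-other : ∀ x S y es → meetsFrom x S ((c' , y) ∷ es) ≡ (elem x S ∧ (x ≡ᵇ y))
  meetsFrom-other x S y es with elem x S
  ... | true  rewrite ≡ᵇ-refl c' | ≡ᵇ-refl c' = refl
  ... | false rewrite ≡ᵇ-refl c' | ∨-zeroʳ ((c' ≡ᵇ c) ∧ (y ≡ᵇ x)) | ≡ᵇ-false c c' c≢c' = refl

  meetsFrom-[] : ∀ x S → χ (meetsFrom x S []) ≡ 0
  meetsFrom-[] x S with elem x S
  ... | true  = refl
  ... | false = refl

  ∑-meetsFrom : ∀ S es → All Spoke es → (∀ y → elem y S ≡ true → Rc y) →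
    ∑ (λ x → χ (meetsFrom x S es)) B ≡ χ (crossesFrom c S es)
  ∑-meetsFrom S [] _ _ = ∑-zero _ B (λ x → meetsFrom-[] x S)
  ∑-meetsFrom S ((_ , y) ∷ es) (inj₁ (refl , ry) ∷ ss) S⊆Rc = begin
      ∑ (λ x → χ (meetsFrom x S ((c , y) ∷ es))) B   ≡⟨ ∑-ext (λ x → cong χ (meetsFrom-same x S y es)) B ⟩
      ∑ (λ x → χ (meetsFrom x (y ∷ S) es)) B         ≡⟨ ∑-meetsFrom (y ∷ S) es ss S⊆Rc' ⟩
      χ (crossesFrom c (y ∷ S) es)                   ≡⟨ cong χ (sym (crossesFrom-same c S y es)) ⟩
      χ (crossesFrom c S ((c , y) ∷ es))             ∎
    where
    open ≡-Reasoning
    S⊆Rc' : ∀ v → elem v (y ∷ S) ≡ true → Rc v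
    S⊆Rc' v e with ∨-true (v ≡ᵇ y) _ e
    ... | inj₁ v≡y rewrite ≡ᵇ-true v y v≡y = ry
    ... | inj₂ v∈S = S⊆Rc v v∈S
  ∑-meetsFrom S ((_ , y) ∷ es) (inj₂ (refl , ry) ∷ ss) S⊆Rc = begin
      ∑ (λ x → χ (meetsFrom x S ((c' , y) ∷ es))) B   ≡⟨ ∑-ext (λ x → cong χ (meetsFrom-other x S y es)) B ⟩
      ∑ (λ x → χ (elem x S ∧ (x ≡ᵇ y))) B             ≡⟨ ∑-at (λ x → elem x S) y B ⟩
      χ (elem y S) * ∑ (λ x → χ (x ≡ᵇ y)) B           ≡⟨ onceIfSeen (elem y S) refl ⟩
      χ (elem y S)                                    ≡⟨ cong χ (sym (crossesFrom-other S y es (λ e → c≢c' (sym e)))) ⟩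
      χ (crossesFrom c S ((c' , y) ∷ es))             ∎
    where
    open ≡-Reasoning
    -- a leaf of both centres is counted once
    onceIfSeen : ∀ b → elem y S ≡ b → χ b * ∑ (λ x → χ (x ≡ᵇ y)) B ≡ χ b
    onceIfSeen true  e = cong (_+ 0) (once y (S⊆Rc y e) ry)
    onceIfSeen false e = refl

select-select : {A : Set} (p q : A → Bool) → (∀ e → q e ≡ true → p e ≡ true) →
  ∀ σ → select q (select p σ) ≡ select q σ
select-select p q q⇒p [] = refl
select-select p q q⇒p (e ∷ σ) with q e in qe
... | true rewrite q⇒p e qe | qe = cong (e ∷_) (select-select p q q⇒p σ)
... | false with p e
...   | true rewrite qe = select-select p q q⇒p σ
...   | false = select-select p q q⇒p σ

-- The probability of meetsAt c c' x is 1 / ((r + 2)(r + 1)), where r + 1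
-- is the number of edges at c': it only depends on the relative order of
-- (c , x) and the edges at c', of which (c , x), (c' , x) must come first.
module MeetingCount (c c' x : ℕ) (c≢c' : c ≢ c') where

  OtherAt : ℕ → Edge → Set
  OtherAt d e = proj₁ e ≡ d × proj₂ e ≢ x

  relevant : Edge → Bool
  relevant e = sameEdge e (c , x) ∨ atCentre c' e

  meetsAt-relevant : ∀ σ → meetsAt c c' x σ
    ≡ (startsWith (sameEdge (c , x)) (select relevant σ) ∧ startsWith (sameEdge (c' , x)) (select (atCentre c') (select relevant σ)))
  meetsAt-relevant σ = cong (λ l → startsWith (sameEdge (c , x)) (select relevant σ) ∧ startsWith (sameEdge (c' , x)) l)
    (sym (select-select relevant (atCentre c') (λ e at → trans (cong (sameEdge e (c , x) ∨_) at) (∨-zeroʳ _)) σ))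

  c≢ᵇc' : (c ≡ᵇ c') ≡ false
  c≢ᵇc' = ≡ᵇ-false c c' c≢c'

  sameEdge-refl : ∀ d → sameEdge (d , x) (d , x) ≡ true
  sameEdge-refl d rewrite ≡ᵇ-refl d | ≡ᵇ-refl x = refl

  atC' : ∀ {R} → All (OtherAt c') R → All (λ e → atCentre c' e ≡ true) R
  atC' = All.map (λ { {d , _} (refl , _) → ≡ᵇ-refl d })

  notCx : ∀ {R} → All (OtherAt c') R → All (λ e → sameEdge (c , x) e ≡ false) R
  notCx = All.map (λ { {_ , y} (refl , _) → cong (_∧ (x ≡ᵇ y)) c≢ᵇc' })

  notC'x : ∀ {R} → All (OtherAt c') R → All (λ e → sameEdge (c' , x) e ≡ false) R
  notC'x = All.map (λ { {d , y} (refl , y≢x) → trans (cong (_∧ (x ≡ᵇ y)) (≡ᵇ-refl d)) (≡ᵇ-false x y (λ e → y≢x (sym e))) })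

  relevantR : ∀ {R} → All (OtherAt c') R → All (λ e → relevant e ≡ true) R
  relevantR = All.map (λ { {d , y} (refl , _) → trans (cong (((d ≡ᵇ c) ∧ (y ≡ᵇ x)) ∨_) (≡ᵇ-refl d)) (∨-zeroʳ _) })

  irrelevantN : ∀ {N} → All (OtherAt c) N → All (λ e → relevant e ≡ false) N
  irrelevantN = All.map (λ { {d , y} (refl , y≢x) → irr d y y≢x })
    where
    irr : ∀ d y → y ≢ x → relevant (c , y) ≡ false
    irr d y y≢x rewrite ≡ᵇ-refl c | ≡ᵇ-false y x y≢x | c≢ᵇc' = refl

  #meetsAt : ∀ E' N R → E' ↭ N ++ (c , x) ∷ (c' , x) ∷ R → All (OtherAt c) N → All (OtherAt c') R →
    ∑ (λ σ → χ (meetsAt c c' x σ)) (orderings E') * ((2 + length R) * (1 + length R)) ≡ length E' !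
  #meetsAt E' N R E'↭ others others' = *-cancelʳ-≡ _ _ (length R !) {{length R !≢0}} (begin
      X * ((2 + r) * (1 + r)) * r !     ≡⟨ unfold! X r (r !) ⟩
      X * (2 + r) !                     ≡⟨ cong (_* (2 + r) !) countRelevant ⟩
      ∑ g (orderings L) * (2 + r) !     ≡⟨ ∑-orderings-select relevant h N S (irrelevantN others) relevantS ⟩
      length L ! * ∑ h (orderings S)    ≡⟨ cong₂ (λ n m → n ! * m) (sym (↭-length E'↭)) firstTwo ⟩
      length E' ! * r !                 ∎)
    where
    open ≡-Reasoning
    r : ℕ
    r = length R
    -- (2 + r)! = (2 + r) * (1 + r) * r!
    unfold! : ∀ X r f → X * ((2 + r) * (1 + r)) * f ≡ X * ((2 + r) * ((1 + r) * f))
    unfold! = solve-∀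
    S L : List Edge
    S = (c , x) ∷ (c' , x) ∷ R
    L = N ++ S
    h : List Edge → ℕ
    h τ = χ (startsWith (sameEdge (c , x)) τ ∧ startsWith (sameEdge (c' , x)) (select (atCentre c') τ))
    g : List Edge → ℕ
    g ρ = h (select relevant ρ)
    X : ℕ
    X = ∑ (λ σ → χ (meetsAt c c' x σ)) (orderings E')
    countRelevant : X ≡ ∑ g (orderings L)
    countRelevant = trans (∑-orderings-↭ E'↭ _) (∑-ext (λ σ → cong χ (meetsAt-relevant σ)) (orderings L))
    relevantS : All (λ e → relevant e ≡ true) S
    relevantS = cong (_∨ (c ≡ᵇ c')) (sameEdge-refl c)
              ∷ trans (cong (((c' ≡ᵇ c) ∧ (x ≡ᵇ x)) ∨_) (≡ᵇ-refl c')) (∨-zeroʳ _)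
              ∷ relevantR others'
    firstTwo : ∑ h (orderings S) ≡ r !
    firstTwo = #startsWith₂ (atCentre c') (sameEdge (c , x)) (sameEdge (c' , x)) (c , x) (c' , x) R
      c≢ᵇc' (≡ᵇ-refl c') (atC' others') (sameEdge-refl c) (cong (_∧ (x ≡ᵇ x)) c≢ᵇc') (notCx others')
      (sameEdge-refl c') (notC'x others')

#trees : Graph → ℕ → ℕ
#trees G k = count (λ ord → numTrees G ord ≡ᵇ k) (orderings (edges G))

/-cong : ∀ p q r s .{{_ : NonZero q}} .{{_ : NonZero s}} → p * s ≡ r * q → ℤ+ p / q ≡ ℤ+ r / s
/-cong p (suc q) r (suc s) e =
  fromℚᵘ-cong {mkℚᵘ (ℤ+ p) q} {mkℚᵘ (ℤ+ r) s} (*≡* (trans (sym (pos-* p (suc s))) (trans (cong ℤ+ e) (pos-* r (suc q)))))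

OneOrTwo : Graph → Set
OneOrTwo G = (#trees G 2 + #trees G 1 ≡ length (edges G) !) × (∀ k → k ≢ 1 → k ≢ 2 → #trees G k ≡ 0)

-- For such graphs, P(G,1) determines the whole distribution.
same-distribution : ∀ G G' → OneOrTwo G → OneOrTwo G' →
  #trees G 1 * length (edges G') ! ≡ #trees G' 1 * length (edges G) ! →
  ∀ k → P G k ≡ P G' k
same-distribution G G' (total , others) (total' , others') one k =
  /-cong (#trees G k) (n !) (#trees G' k) (n' !) {{n !≢0}} {{n' !≢0}} (cross k)
  where
  n n' : ℕ
  n  = length (edges G)
  n' = length (edges G')
  cross : ∀ k → #trees G k * n' ! ≡ #trees G' k * n !
  cross k with k ≟ 1 | k ≟ 2
  ... | yes refl | _        = one
  ... | no k≢1   | no k≢2   rewrite others k k≢1 k≢2 | others' k k≢1 k≢2 = refl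
  ... | no _     | yes refl = +-cancelʳ-≡ (#trees G' 1 * n !) _ _ (begin
      #trees G 2 * n' ! + #trees G' 1 * n !      ≡⟨ cong (#trees G 2 * n' ! +_) (sym one) ⟩
      #trees G 2 * n' ! + #trees G 1 * n' !      ≡⟨ sym (*-distribʳ-+ (n' !) (#trees G 2) _) ⟩
      (#trees G 2 + #trees G 1) * n' !           ≡⟨ cong (_* n' !) total ⟩
      n ! * n' !                                 ≡⟨ *-comm (n !) (n' !) ⟩
      n' ! * n !                                 ≡⟨ cong (_* n !) (sym total') ⟩
      (#trees G' 2 + #trees G' 1) * n !          ≡⟨ *-distribʳ-+ (n !) (#trees G' 2) _ ⟩
      #trees G' 2 * n ! + #trees G' 1 * n !      ∎)
    where open ≡-Reasoning

interval : ℕ → ℕ → List ℕ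
interval s zero    = []
interval s (suc n) = s ∷ interval (suc s) n

range≡interval : ∀ s n → range s n ≡ interval s n
range≡interval s n = trans (map-applyUpTo (λ i → i) (s +_) n) (go s n (λ i → refl))
  where
  go : ∀ {h : ℕ → ℕ} s n → (∀ i → h i ≡ s + i) → applyUpTo h n ≡ interval s n
  go s zero    e = refl
  go s (suc n) e = cong₂ _∷_ (trans (e 0) (+-identityʳ s)) (go (suc s) n (λ i → trans (e (suc i)) (+-suc s i)))

interval-bounds : ∀ {s n y} → y ∈ interval s n → s ≤ y × y < s + n
interval-bounds {s} {suc n} (here refl) = ≤-refl , subst (s <_) (sym (+-suc s n)) (s≤s (m≤m+n s n))
interval-bounds {s} {suc n} {y} (there m) with interval-bounds {suc s} {n} m
... | lo , hi = ≤-trans (n≤1+n s) lo , subst (y <_) (sym (+-suc s n)) hi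

interval-intro : ∀ {s n y} → s ≤ y → y < s + n → y ∈ interval s n
interval-intro {s} {zero}  {y} lo hi = ⊥-elim (<-irrefl refl (<-≤-trans hi (subst (_≤ y) (sym (+-identityʳ s)) lo)))
interval-intro {s} {suc n} {y} lo hi with y ≟ s
... | yes refl = here refl
... | no y≢s   = there (interval-intro (≤∧≢⇒< lo (λ e → y≢s (sym e))) (subst (y <_) (+-suc s n) hi))

length-interval : ∀ s n → length (interval s n) ≡ n
length-interval s zero    = refl
length-interval s (suc n) = cong suc (length-interval (suc s) n)

interval-split : ∀ s i j → interval s (i + suc j) ≡ interval s i ++ (s + i) ∷ interval (suc (s + i)) j
interval-split s zero    j rewrite +-identityʳ s = refl
interval-split s (suc i) j rewrite +-suc s i     = cong (s ∷_) (interval-split (suc s) i j)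

interval-once : ∀ {s n y} → s ≤ y → y < s + n → ∑ (λ x → χ (x ≡ᵇ y)) (interval s n) ≡ 1
interval-once {s} {zero}  {y} lo hi = ⊥-elim (<-irrefl refl (<-≤-trans hi (subst (_≤ y) (sym (+-identityʳ s)) lo)))
interval-once {s} {suc n} {y} lo hi with y ≟ s
... | yes refl rewrite ≡ᵇ-refl y = cong suc (∑-zero-on (interval (suc y) n) (All.tabulate later))
  where
  ∑-zero-on : ∀ xs → All (λ x → χ (x ≡ᵇ y) ≡ 0) xs → ∑ (λ x → χ (x ≡ᵇ y)) xs ≡ 0
  ∑-zero-on xs zs = trans (∑-cong zs) (∑-zero (λ _ → 0) xs (λ _ → refl))
  later : ∀ {x} → x ∈ interval (suc y) n → χ (x ≡ᵇ y) ≡ 0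
  later m = cong χ (≡ᵇ-false _ y (λ e → <-irrefl (sym e) (proj₁ (interval-bounds m))))
... | no y≢s rewrite ≡ᵇ-false s y (λ e → y≢s (sym e)) =
  interval-once (≤∧≢⇒< lo (λ e → y≢s (sym e))) (subst (y <_) (+-suc s n) hi)

pairs : List ℕ → List Edge
pairs []       = []
pairs (y ∷ ys) = (0 , y) ∷ (1 , y) ∷ pairs ys

concatMap≡pairs : ∀ ys → concatMap (λ x → (0 , x) ∷ (1 , x) ∷ []) ys ≡ pairs ys
concatMap≡pairs []       = refl
concatMap≡pairs (y ∷ ys) = cong (λ l → (0 , y) ∷ (1 , y) ∷ l) (concatMap≡pairs ys)

pairs-All : ∀ {P : Edge → Set} {ys} → All (λ y → P (0 , y) × P (1 , y)) ys → All P (pairs ys)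
pairs-All []            = []
pairs-All ((p , q) ∷ r) = p ∷ q ∷ pairs-All r

∈-pairs : ∀ {y ys} → y ∈ ys → (0 , y) ∈ pairs ys
∈-pairs (here refl) = here refl
∈-pairs (there m)   = there (there (∈-pairs m))

spokes : ℕ → List ℕ → List Edge
spokes d = map (d ,_)

pairs↭ : ∀ X → pairs X ↭ spokes 0 X ++ spokes 1 X
pairs↭ []      = ↭-refl
pairs↭ (y ∷ X) = ↭-prep (0 , y) (↭-trans (↭-prep (1 , y) (pairs↭ X)) (↭-sym (shift (1 , y) (spokes 0 X) (spokes 1 X))))

pairs-++ : ∀ X Z → pairs (X ++ Z) ≡ pairs X ++ pairs Z
pairs-++ []      Z = refl
pairs-++ (y ∷ X) Z = cong (λ l → (0 , y) ∷ (1 , y) ∷ l) (pairs-++ X Z)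

gather↭ : {A : Set} (P Q P' Q' C : List A) (u v : A) →
  ((P ++ Q) ++ u ∷ v ∷ (P' ++ Q')) ++ C ↭ (P ++ P') ++ u ∷ v ∷ (Q ++ Q' ++ C)
gather↭ (e ∷ P) Q P' Q' C u v = ↭-prep e (gather↭ P Q P' Q' C u v)
gather↭ []      Q P' Q' C u v = begin
    (Q ++ u ∷ v ∷ (P' ++ Q')) ++ C     ≡⟨ ++-assoc Q (u ∷ v ∷ (P' ++ Q')) C ⟩
    Q ++ u ∷ v ∷ ((P' ++ Q') ++ C)     ≡⟨ cong (λ z → Q ++ u ∷ v ∷ z) (++-assoc P' Q' C) ⟩
    Q ++ (u ∷ v ∷ P') ++ Q' ++ C       ↭⟨ shifts Q (u ∷ v ∷ P') ⟩
    (u ∷ v ∷ []) ++ P' ++ Q ++ Q' ++ C ↭⟨ shifts (u ∷ v ∷ []) P' ⟩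
    P' ++ u ∷ v ∷ (Q ++ Q' ++ C)       ∎
  where open PermutationReasoning

reverse↭ : {A : Set} (N R : List A) (u v : A) → N ++ u ∷ v ∷ R ↭ R ++ v ∷ u ∷ N
reverse↭ N R u v = ↭-trans (++-comm N (u ∷ v ∷ R)) (↭-trans (↭-swap u v ↭-refl) (shifts (v ∷ u ∷ []) R))

module GluedStar (a b c : ℕ) where

  As Bs Cs Leaves : List ℕ
  As     = interval 2 a
  Bs     = interval (2 + a) b
  Cs     = interval (2 + a + b) c
  Leaves = interval 2 (a + b + c)

  E : List Edge
  E = spokes 0 As ++ pairs Bs ++ spokes 1 Cs

  edges≡ : edges (GS a b c) ≡ E
  edges≡ rewrite range≡interval 2 a | range≡interval (2 + a) b | range≡interval (2 + a + b) c
               | concatMap≡pairs (interval (2 + a) b) = refl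

  vertices≡ : vertices (GS a b c) ≡ 0 ∷ 1 ∷ Leaves
  vertices≡ rewrite range≡interval 2 (a + b + c) = refl

  E-All : ∀ {P : Edge → Set} → (∀ {y} → y ∈ As → P (0 , y)) → (∀ {y} → y ∈ Bs → P (0 , y) × P (1 , y)) →
          (∀ {y} → y ∈ Cs → P (1 , y)) → All P E
  E-All pA pB pC = ++⁺ (map⁺ (All.tabulate pA)) (++⁺ (pairs-All (All.tabulate pB)) (map⁺ (All.tabulate pC)))

  Leaf₀ Leaf₁ : ℕ → Set
  Leaf₀ y = y < 2 + a + b
  Leaf₁ y = 2 + a ≤ y

  Spoke₀₁ : Edge → Set
  Spoke₀₁ e = (proj₁ e ≡ 0 × Leaf₀ (proj₂ e)) ⊎ (proj₁ e ≡ 1 × Leaf₁ (proj₂ e))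

  2+a≤2+a+b : 2 + a ≤ 2 + a + b
  2+a≤2+a+b = m≤m+n (2 + a) b

  E-spokes : All Spoke₀₁ E
  E-spokes = E-All
    (λ m → inj₁ (refl , <-≤-trans (proj₂ (interval-bounds m)) 2+a≤2+a+b))
    (λ m → inj₁ (refl , proj₂ (interval-bounds m)) , inj₂ (refl , proj₁ (interval-bounds m)))
    (λ m → inj₂ (refl , ≤-trans 2+a≤2+a+b (proj₁ (interval-bounds m))))

  E-leaves : All (λ e → proj₁ e < 2 × proj₂ e ∈ Leaves) E
  E-leaves = E-All (λ m → s≤s z≤n , leaf m ≤-refl (s≤s (s≤s (≤-trans (m≤m+n a b) (m≤m+n (a + b) c)))))
                   (λ m → (s≤s z≤n , inB m) , (s≤s (s≤s z≤n) , inB m))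
                   (λ m → s≤s (s≤s z≤n) , leaf m (m≤m+n 2 (a + b)) ≤-refl)
    where
    leaf : ∀ {s n y} → y ∈ interval s n → 2 ≤ s → s + n ≤ 2 + (a + b + c) → y ∈ Leaves
    leaf m 2≤s top = interval-intro (≤-trans 2≤s (proj₁ (interval-bounds m))) (<-≤-trans (proj₂ (interval-bounds m)) top)
    inB : ∀ {y} → y ∈ Bs → y ∈ Leaves
    inB m = leaf m (m≤m+n 2 a) (s≤s (s≤s (m≤m+n (a + b) c)))

  E-covers : ∀ {v} → v ∈ Leaves → Any (λ e → proj₂ e ≡ v) E
  E-covers {v} m with interval-bounds {2} {a + b + c} m
  ... | lo , hi with v <? 2 + a
  ...   | yes v<  = ++⁺ˡ (lose (∈-map⁺ (0 ,_) (interval-intro {2} {a} lo v<)) refl)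
  ...   | no v≮ with v <? 2 + a + b
  ...     | yes v<' = ++⁺ʳ (spokes 0 As) (++⁺ˡ (lose (∈-pairs (interval-intro {2 + a} {b} (≮⇒≥ v≮) v<')) refl))
  ...     | no v≮'  = ++⁺ʳ (spokes 0 As) (++⁺ʳ (pairs Bs) (lose (∈-map⁺ (1 ,_) (interval-intro {2 + a + b} {c} (≮⇒≥ v≮') hi)) refl))

  numTrees≡ : ∀ {σ} → σ ∈ orderings E → numTrees (GS a b c) σ ≡ (if crosses σ then 1 else 2)
  numTrees≡ {σ} σ∈ = trans (cong (λ V → numComponents V (forest σ)) vertices≡)
    (numComponents-forest Leaves σ (All.map (λ (c<2 , y∈) → c<2 , proj₁ (interval-bounds y∈)) leavesσ)
      (All.tabulate (λ m → proj₁ (interval-bounds m))) (All.map proj₂ leavesσ) covered)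
    where
    leavesσ : All (λ e → proj₁ e < 2 × proj₂ e ∈ Leaves) σ
    leavesσ = All.lookup (orderings-All E-leaves) σ∈
    covered : ∀ {v} → v ∈ Leaves → ∃[ e ] e ∈ σ × proj₂ e ≡ v
    covered v∈ = find (All.lookup (orderings-Any (E-covers v∈)) σ∈)

  -- Each shared leaf occurs once in Bs, so the scan splits over Bs.
  once : ∀ y → Leaf₀ y → Leaf₁ y → ∑ (λ x → χ (x ≡ᵇ y)) Bs ≡ 1
  once y y< 2+a≤ = interval-once 2+a≤ y<

  module Meet₀₁ = Decomposition Bs 0 1 (λ ()) Leaf₀ Leaf₁ once
  module Meet₁₀ = Decomposition Bs 1 0 (λ ()) Leaf₁ Leaf₀ (λ y l₁ l₀ → once y l₀ l₁)

  crosses-split : ∀ σ → All Spoke₀₁ σ → χ (crosses σ) ≡ ∑ (λ x → χ (meetsAt 0 1 x σ) + χ (meetsAt 1 0 x σ)) Bs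
  crosses-split []                  _ = sym (∑-zero _ Bs (λ _ → refl))
  crosses-split ((0 , y) ∷ es) spokes@(inj₁ (refl , _) ∷ _) =
    sym (trans (∑-ext (λ x → +-identityʳ _) Bs) (Meet₀₁.∑-meetsFrom [] ((0 , y) ∷ es) spokes (λ _ ())))
  crosses-split ((1 , y) ∷ es) spokes@(inj₂ (refl , _) ∷ _) =
    sym (Meet₁₀.∑-meetsFrom [] ((1 , y) ∷ es) (All.map swap spokes) (λ _ ()))
    where
    swap : ∀ {e} → Spoke₀₁ e → Meet₁₀.Spoke e
    swap (inj₁ s) = inj₂ s
    swap (inj₂ s) = inj₁ s

  n sw su : ℕ
  n  = length E
  sw = suc (b + c) * (b + c)    -- (degree of 1 + 1) * degree of 1
  su = suc (a + b) * (a + b)    -- (degree of 0 + 1) * degree of 0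

  meets₀₁ meets₁₀ : ℕ → ℕ
  meets₀₁ x = ∑ (λ σ → χ (meetsAt 0 1 x σ)) (orderings E)
  meets₁₀ x = ∑ (λ σ → χ (meetsAt 1 0 x σ)) (orderings E)

  module MC₀₁ x = MeetingCount 0 1 x (λ ())
  module MC₁₀ x = MeetingCount 1 0 x (λ ())

  module SharedLeaf (i j : ℕ) (b≡ : b ≡ i + suc j) where

    x : ℕ
    x = 2 + a + i

    X Y : List ℕ
    X = interval (2 + a) i
    Y = interval (suc x) j

    N R : List Edge
    N = spokes 0 As ++ spokes 0 X ++ spokes 0 Y
    R = spokes 1 X ++ spokes 1 Y ++ spokes 1 Cs

    E≡ : E ≡ spokes 0 As ++ (pairs X ++ (0 , x) ∷ (1 , x) ∷ pairs Y) ++ spokes 1 Cs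
    E≡ = trans (cong (λ B → spokes 0 As ++ pairs B ++ spokes 1 Cs) (trans (cong (interval (2 + a)) b≡) (interval-split (2 + a) i j)))
               (cong (λ l → spokes 0 As ++ l ++ spokes 1 Cs) (pairs-++ X (x ∷ Y)))

    E↭ : E ↭ N ++ (0 , x) ∷ (1 , x) ∷ R
    E↭ = ↭-trans (↭-reflexive E≡)
           (↭-trans (↭-++⁺ˡ (spokes 0 As) (↭-++⁺ʳ (spokes 1 Cs) (↭-++⁺ (pairs↭ X) (↭-prep (0 , x) (↭-prep (1 , x) (pairs↭ Y))))))
                    (↭-trans (↭-++⁺ˡ (spokes 0 As) (gather↭ (spokes 0 X) (spokes 1 X) (spokes 0 Y) (spokes 1 Y) (spokes 1 Cs) (0 , x) (1 , x)))
                             (↭-reflexive (sym (++-assoc (spokes 0 As) (spokes 0 X ++ spokes 0 Y) ((0 , x) ∷ (1 , x) ∷ R))))))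

    x<2+a+b : x < 2 + a + b
    x<2+a+b = subst (x <_) (cong (2 + a +_) (sym b≡)) (+-monoʳ-< (2 + a) (subst (i <_) (sym (+-suc i j)) (s≤s (m≤m+n i j))))

    otherLeaves : ∀ (d : ℕ) {L} → (∀ {y} → y ∈ L → y ≢ x) → All (MC₀₁.OtherAt x d) (spokes d L)
    otherLeaves d ≢x = map⁺ (All.tabulate (λ m → refl , ≢x m))

    ≢x-As : ∀ {y} → y ∈ As → y ≢ x
    ≢x-As m e = <-irrefl e (<-≤-trans (proj₂ (interval-bounds m)) (m≤m+n (2 + a) i))
    ≢x-X : ∀ {y} → y ∈ X → y ≢ x
    ≢x-X m e = <-irrefl e (proj₂ (interval-bounds m))
    ≢x-Y : ∀ {y} → y ∈ Y → y ≢ x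
    ≢x-Y m e = <-irrefl (sym e) (proj₁ (interval-bounds m))
    ≢x-Cs : ∀ {y} → y ∈ Cs → y ≢ x
    ≢x-Cs m e = <-irrefl (sym e) (<-≤-trans x<2+a+b (proj₁ (interval-bounds m)))

    others₀ : All (MC₀₁.OtherAt x 0) N
    others₀ = ++⁺ (otherLeaves 0 ≢x-As) (++⁺ (otherLeaves 0 ≢x-X) (otherLeaves 0 ≢x-Y))
    others₁ : All (MC₀₁.OtherAt x 1) R
    others₁ = ++⁺ (otherLeaves 1 ≢x-X) (++⁺ (otherLeaves 1 ≢x-Y) (otherLeaves 1 ≢x-Cs))

    length-spokes : ∀ d s k → length (spokes d (interval s k)) ≡ k
    length-spokes d s k = trans (length-map _ (interval s k)) (length-interval s k)

    length-R : length R ≡ i + (j + c)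
    length-R = trans (length-++ (spokes 1 X)) (cong₂ _+_ (length-spokes 1 (2 + a) i)
                 (trans (length-++ (spokes 1 Y)) (cong₂ _+_ (length-spokes 1 (suc x) j) (length-spokes 1 (2 + a + b) c))))
    length-N : length N ≡ a + (i + j)
    length-N = trans (length-++ (spokes 0 As)) (cong₂ _+_ (length-spokes 0 2 a)
                 (trans (length-++ (spokes 0 X)) (cong₂ _+_ (length-spokes 0 (2 + a) i) (length-spokes 0 (suc x) j))))

    sw≡ : (2 + length R) * (1 + length R) ≡ sw
    sw≡ rewrite length-R | b≡ = shape i j c
      where
      shape : ∀ i j c → (2 + (i + (j + c))) * (1 + (i + (j + c))) ≡ suc (i + suc j + c) * (i + suc j + c)
      shape = solve-∀
    su≡ : (2 + length N) * (1 + length N) ≡ su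
    su≡ rewrite length-N | b≡ = shape a i j
      where
      shape : ∀ a i j → (2 + (a + (i + j))) * (1 + (a + (i + j))) ≡ suc (a + (i + suc j)) * (a + (i + suc j))
      shape = solve-∀

    count₀₁ : meets₀₁ x * sw ≡ n !
    count₀₁ = trans (cong (meets₀₁ x *_) (sym sw≡)) (MC₀₁.#meetsAt x E N R E↭ others₀ others₁)
    count₁₀ : meets₁₀ x * su ≡ n !
    count₁₀ = trans (cong (meets₁₀ x *_) (sym su≡))
                    (MC₁₀.#meetsAt x E R N (↭-trans E↭ (reverse↭ N R (0 , x) (1 , x))) others₁ others₀)

  split : ∀ {x} → x ∈ Bs → ∃[ i ] ∃[ j ] x ≡ 2 + a + i × b ≡ i + suc j
  split {x} m with interval-bounds {2 + a} {b} m
  ... | lo , hi = i , b ∸ suc i , sym (m+[n∸m]≡n lo) , b≡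
    where
    i : ℕ
    i = x ∸ (2 + a)
    i<b : i < b
    i<b = +-cancelˡ-< (2 + a) i b (subst (_< 2 + a + b) (sym (m+[n∸m]≡n lo)) hi)
    b≡ : b ≡ i + suc (b ∸ suc i)
    b≡ = trans (sym (m+[n∸m]≡n i<b)) (sym (+-suc i (b ∸ suc i)))

  count₀₁ : ∀ {x} → x ∈ Bs → meets₀₁ x * sw ≡ n !
  count₀₁ m with split m
  ... | i , j , refl , b≡ = SharedLeaf.count₀₁ i j b≡

  count₁₀ : ∀ {x} → x ∈ Bs → meets₁₀ x * su ≡ n !
  count₁₀ m with split m
  ... | i , j , refl , b≡ = SharedLeaf.count₁₀ i j b≡

  #crossing : ℕ
  #crossing = ∑ (λ σ → χ (crosses σ)) (orderings E)

  #crossing-rate : #crossing * (sw * su) ≡ b * (su + sw) * n !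
  #crossing-rate = begin
      #crossing * (sw * su)
        ≡⟨ cong (_* (sw * su)) (∑-cong (All.map (λ {σ} → crosses-split σ) (orderings-All E-spokes))) ⟩
      ∑ (λ σ → ∑ (λ x → χ (meetsAt 0 1 x σ) + χ (meetsAt 1 0 x σ)) Bs) (orderings E) * (sw * su)
        ≡⟨ cong (_* (sw * su)) (∑-swap _ (orderings E) Bs) ⟩
      ∑ (λ x → ∑ (λ σ → χ (meetsAt 0 1 x σ) + χ (meetsAt 1 0 x σ)) (orderings E)) Bs * (sw * su)
        ≡⟨ cong (_* (sw * su)) (∑-ext (λ x → ∑-+ _ _ (orderings E)) Bs) ⟩
      ∑ (λ x → meets₀₁ x + meets₁₀ x) Bs * (sw * su)
        ≡⟨ ∑-*ʳ _ (sw * su) Bs ⟩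
      ∑ (λ x → (meets₀₁ x + meets₁₀ x) * (sw * su)) Bs
        ≡⟨ ∑-cong (All.tabulate perLeaf) ⟩
      ∑ (λ _ → n ! * (su + sw)) Bs
        ≡⟨ ∑-const _ Bs ⟩
      n ! * (su + sw) * length Bs
        ≡⟨ cong (n ! * (su + sw) *_) (length-interval (2 + a) b) ⟩
      n ! * (su + sw) * b
        ≡⟨ reorder (n !) (su + sw) b ⟩
      b * (su + sw) * n ! ∎
    where
    open ≡-Reasoning
    expand : ∀ p q u v → (p + q) * (u * v) ≡ p * u * v + q * v * u
    expand = solve-∀
    factor : ∀ m u v → m * v + m * u ≡ m * (v + u)
    factor = solve-∀
    reorder : ∀ m s b → m * s * b ≡ b * s * m
    reorder = solve-∀
    perLeaf : ∀ {x} → x ∈ Bs → (meets₀₁ x + meets₁₀ x) * (sw * su) ≡ n ! * (su + sw)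
    perLeaf {x} m = trans (expand (meets₀₁ x) (meets₁₀ x) sw su)
      (trans (cong₂ _+_ (cong (_* su) (count₀₁ m)) (cong (_* sw) (count₁₀ m))) (factor (n !) sw su))

  #trees≡ : ∀ k → #trees (GS a b c) k ≡ ∑ (λ σ → χ ((if crosses σ then 1 else 2) ≡ᵇ k)) (orderings E)
  #trees≡ k rewrite edges≡ =
    trans (count≡∑ _ (orderings E)) (∑-cong (All.tabulate (λ σ∈ → cong (λ m → χ (m ≡ᵇ k)) (numTrees≡ σ∈))))

  #trees-1 : #trees (GS a b c) 1 ≡ #crossing
  #trees-1 = trans (#trees≡ 1) (∑-ext oneTree (orderings E))
    where
    oneTree : ∀ σ → χ ((if crosses σ then 1 else 2) ≡ᵇ 1) ≡ χ (crosses σ)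
    oneTree σ with crosses σ
    ... | true  = refl
    ... | false = refl

  oneOrTwo : OneOrTwo (GS a b c)
  oneOrTwo = total , others
    where
    total : #trees (GS a b c) 2 + #trees (GS a b c) 1 ≡ length (edges (GS a b c)) !
    total = begin
        #trees (GS a b c) 2 + #trees (GS a b c) 1
          ≡⟨ cong₂ _+_ (#trees≡ 2) (#trees≡ 1) ⟩
        ∑ (λ σ → χ (trees σ ≡ᵇ 2)) (orderings E) + ∑ (λ σ → χ (trees σ ≡ᵇ 1)) (orderings E)
          ≡⟨ sym (∑-+ _ _ (orderings E)) ⟩
        ∑ (λ σ → χ (trees σ ≡ᵇ 2) + χ (trees σ ≡ᵇ 1)) (orderings E)
          ≡⟨ ∑-ext oneOf (orderings E) ⟩
        ∑ (λ _ → 1) (orderings E)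
          ≡⟨ sym (length≡∑ (orderings E)) ⟩
        length (orderings E)
          ≡⟨ #orderings E ⟩
        length E !
          ≡⟨ cong (λ l → length l !) (sym edges≡) ⟩
        length (edges (GS a b c)) ! ∎
      where
      open ≡-Reasoning
      trees : List Edge → ℕ
      trees σ = if crosses σ then 1 else 2
      oneOf : ∀ σ → χ (trees σ ≡ᵇ 2) + χ (trees σ ≡ᵇ 1) ≡ 1
      oneOf σ with crosses σ
      ... | true  = refl
      ... | false = refl
    others : ∀ k → k ≢ 1 → k ≢ 2 → #trees (GS a b c) k ≡ 0
    others k k≢1 k≢2 = trans (#trees≡ k) (∑-zero _ (orderings E) neither)
      where
      neither : ∀ σ → χ ((if crosses σ then 1 else 2) ≡ᵇ k) ≡ 0
      neither σ with crosses σ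
      ... | true  rewrite ≡ᵇ-false 1 k (λ e → k≢1 (sym e)) = refl
      ... | false rewrite ≡ᵇ-false 2 k (λ e → k≢2 (sym e)) = refl

  tree-rate : #trees (GS a b c) 1 * (sw * su) ≡ b * (su + sw) * length (edges (GS a b c)) !
  tree-rate = trans (cong (_* (sw * su)) #trees-1)
                    (trans #crossing-rate (cong (λ m → b * (su + sw) * length m !) (sym edges≡)))

equal-rates : ∀ C₁ C₂ N₁ N₂ K₁ K₂ q₁ q₂ .{{_ : NonZero (K₁ * K₂)}} →
  C₁ * K₁ ≡ q₁ * N₁ → C₂ * K₂ ≡ q₂ * N₂ → q₁ * K₂ ≡ q₂ * K₁ → C₁ * N₂ ≡ C₂ * N₁
equal-rates C₁ C₂ N₁ N₂ K₁ K₂ q₁ q₂ e₁ e₂ rates = *-cancelʳ-≡ (C₁ * N₂) (C₂ * N₁) (K₁ * K₂) (begin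
    C₁ * N₂ * (K₁ * K₂)      ≡⟨ regroup₁ C₁ N₂ K₁ K₂ ⟩
    C₁ * K₁ * (N₂ * K₂)      ≡⟨ cong (_* (N₂ * K₂)) e₁ ⟩
    q₁ * N₁ * (N₂ * K₂)      ≡⟨ regroup₂ q₁ N₁ N₂ K₂ ⟩
    q₁ * K₂ * (N₁ * N₂)      ≡⟨ cong (_* (N₁ * N₂)) rates ⟩
    q₂ * K₁ * (N₁ * N₂)      ≡⟨ regroup₃ q₂ K₁ N₁ N₂ ⟩
    q₂ * N₂ * (N₁ * K₁)      ≡⟨ cong (_* (N₁ * K₁)) (sym e₂) ⟩
    C₂ * K₂ * (N₁ * K₁)      ≡⟨ regroup₄ C₂ K₂ N₁ K₁ ⟩
    C₂ * N₁ * (K₁ * K₂)      ∎)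
  where
  open ≡-Reasoning
  regroup₁ : ∀ c n k k' → c * n * (k * k') ≡ c * k * (n * k')
  regroup₁ = solve-∀
  regroup₂ : ∀ q n n' k' → q * n * (n' * k') ≡ q * k' * (n * n')
  regroup₂ = solve-∀
  regroup₃ : ∀ q k n n' → q * k * (n * n') ≡ q * n' * (n * k)
  regroup₃ = solve-∀
  regroup₄ : ∀ c k' n k → c * k' * (n * k) ≡ c * n * (k * k')
  regroup₄ = solve-∀

rates-agree : ∀ t →
  let sw₁ = suc (t + 2 * t) * (t + 2 * t)
      su₁ = suc (5 * t + 3 + t) * (5 * t + 3 + t)
      sw₂ = suc (t + 1 + (2 * t + 1)) * (t + 1 + (2 * t + 1))
      su₂ = suc (5 * t + 1 + (t + 1)) * (5 * t + 1 + (t + 1))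
  in t * (su₁ + sw₁) * (sw₂ * su₂) ≡ (t + 1) * (su₂ + sw₂) * (sw₁ * su₁)
rates-agree = solve-∀

proposition5 : (t : ℕ) → 1 ≤ t → (k : ℕ) →
    P (GS (5 * t + 3) t (2 * t)) k ≡ P (GS (5 * t + 1) (t + 1) (2 * t + 1)) k
proposition5 zero ()
proposition5 t@(suc _) _ = same-distribution GS₁ GS₂ G₁.oneOrTwo G₂.oneOrTwo
  (equal-rates (#trees GS₁ 1) (#trees GS₂ 1) (length (edges GS₁) !) (length (edges GS₂) !)
               (G₁.sw * G₁.su) (G₂.sw * G₂.su) (t * (G₁.su + G₁.sw)) ((t + 1) * (G₂.su + G₂.sw))
               G₁.tree-rate G₂.tree-rate (rates-agree t))
  where
  GS₁ GS₂ : Graph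
  GS₁ = GS (5 * t + 3) t (2 * t)
  GS₂ = GS (5 * t + 1) (t + 1) (2 * t + 1)
  module G₁ = GluedStar (5 * t + 3) t (2 * t)
  module G₂ = GluedStar (5 * t + 1) (t + 1) (2 * t + 1)
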